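{- Let $P$ be a rooted tree poset with $n$ elements and let $L$ be a labeling of $P$. Let $b$ be the highest branch vertex of $P$, let $c_1<_P\cdots<_P c_k$ be the maximal $L$-golden chain consisting of elements greater than or equal to $b$, and let $\mathcal{M}$ be the set of all maximal $L$-golden rooted subtrees of $P$ whose roots are less than $b$. If $L^{ -1}(n)$ is a maximal element of $P$ (equivalently, $L$ lies in the image of $\partial$), then \[|\partial^{ -1}(L)|=2^{k-1}+\sum_{T\in\mathcal{M}}\sum_{x\in T}2^{\omega(x)+k-2},\] where $\omega(x)$ is the number of elements on the path from $x$ to the root of $T$ (including both), computed within $T$ rather than within $P$.
   Context: A labeling of an $n$-element poset $P$ is a bijection $L:P\to[n]$. Extended promotion $\partial$: for a labeling $L$, the promotion chain is $v_1=L^{ -1}(1)$, and $v_{i+1}$ is the element above $v_i$ with smallest label (the $L$-successor), stopping at the first maximal element $v_m$; then $\partial(L)(x)=L(x)-1$ for $x$ off the chain, $\partial(L)(v_i)=L(v_{i+1})-1$ for $i<m$, $\partial(L)(v_m)=n$. A rooted tree poset is a connected poset in which each element is covered by at most one other element (its Hasse diagram is a rooted tree whose root is the unique maximal element). A subset of $P$ is a subchain (resp. subtree) if the induced subposet is a chain (resp. rooted tree). The highest branch vertex of $P$ is the largest element of $P$ that covers more than one element. An element $x$ is $L$-golden if $L(y)>L(x)$ for all $y>_P x$; a chain or subtree is $L$-golden if all its elements are; an $L$-golden subchain or subtree is maximal if adding any other elements makes it no longer an $L$-golden subchain or subtree. -}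

module Defs where

open import Level using (0ℓ)
open import Data.Nat using (ℕ; zero; suc; _+_; _∸_; _^_) renaming (_≤_ to _≤ℕ_; _<_ to _<ℕ_; _≟_ to _≟ℕ_; _<?_ to _<ℕ?_)
open import Data.Bool using (Bool; true; false; if_then_else_; _∧_)
open import Data.Fin using (Fin) renaming (_≟_ to _≟F_)
open import Data.Fin.Subset using (Subset; _∈_; _⊆_; ⊤)
open import Data.Fin.Subset.Properties using (_∈?_)
open import Data.Vec using (Vec; lookup; tabulate)
open import Data.List using (List; []; _∷_; length; map; filter; foldr)
open import Data.Nat.ListAction using (sum)
open import Data.List.Membership.Propositional using () renaming (_∈_ to _∈ᴸ_)
open import Data.List.Relation.Unary.Unique.Propositional using (Unique)
open import Data.List.Relation.Unary.Any using (any?)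
open import Data.Maybe using (Maybe; just; nothing; maybe)
open import Data.Product using (Σ; ∃; ∃-syntax; _×_; _,_)
open import Data.Sum using (_⊎_)
open import Data.Empty using (⊥)
open import Relation.Nullary using (¬_; Dec; yes; no; does)
open import Relation.Nullary.Decidable using (⌊_⌋)
open import Relation.Binary using (Rel; Decidable; IsPartialOrder)
open import Relation.Binary.PropositionalEquality using (_≡_; _≢_)
open import Relation.Binary.Construct.Closure.ReflexiveTransitive using (Star)
open import Function.Bundles using (_⇔_)
open import Data.List.Base using (allFin)

HasCard : {A : Set} → (A → Set) → ℕ → Set
HasCard {A} P m =
  Σ (List A) λ xs → Unique xs × (∀ a → (a ∈ᴸ xs) ⇔ P a) × length xs ≡ m

record FinPoset (n : ℕ) : Set₁ where
  field
    _≤_            : Rel (Fin n) 0ℓ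
    isPartialOrder : IsPartialOrder _≡_ _≤_
    _≤?_           : Decidable _≤_

  infix 4 _<_ _⋖_
  _<_ : Rel (Fin n) 0ℓ
  x < y = x ≤ y × x ≢ y

  _<?_ : Decidable _<_
  x <? y with x ≤? y | x ≟F y
  ... | yes p | no q  = yes (p , q)
  ... | yes p | yes q = no λ { (_ , r) → r q }
  ... | no p  | _     = no λ { (r , _) → p r }

  _⋖_ : Rel (Fin n) 0ℓ
  x ⋖ y = x < y × (∀ z → x < z → z < y → ⊥)

  CoversIn : Subset n → Fin n → Fin n → Set
  CoversIn S x y = x ∈ S × y ∈ S × x < y × (∀ z → z ∈ S → x < z → z < y → ⊥)

  ConnectedIn : Subset n → Set
  ConnectedIn S =
    (∃[ x ] x ∈ S) ×
    (∀ x y → x ∈ S → y ∈ S →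
       Star (λ a b → a ∈ S × b ∈ S × (a ≤ b ⊎ b ≤ a)) x y)

  IsRootedTreeOn : Subset n → Set
  IsRootedTreeOn S =
    ConnectedIn S × (∀ x y z → CoversIn S x y → CoversIn S x z → y ≡ z)

  IsChainOn : Subset n → Set
  IsChainOn S = ∀ x y → x ∈ S → y ∈ S → x ≤ y ⊎ y ≤ x

  RootOf : Subset n → Fin n → Set
  RootOf S r = r ∈ S × (∀ x → x ∈ S → x ≤ r)

  IsRootedTreePoset : Set
  IsRootedTreePoset = IsRootedTreeOn ⊤

  IsMaximal : Fin n → Set
  IsMaximal x = ∀ y → x ≤ y → x ≡ y

  IsBranch : Fin n → Set
  IsBranch x = Σ (Fin n) λ y₁ → Σ (Fin n) λ y₂ → y₁ ≢ y₂ × y₁ ⋖ x × y₂ ⋖ x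

  IsHighestBranch : Fin n → Set
  IsHighestBranch b = IsBranch b × (∀ x → IsBranch x → x ≤ b)

  IsLabeling : Vec ℕ n → Set
  IsLabeling L =
    (∀ x → 1 ≤ℕ lookup L x × lookup L x ≤ℕ n) ×
    (∀ x y → lookup L x ≡ lookup L y → x ≡ y) ×
    (∀ i → 1 ≤ℕ i → i ≤ℕ n → ∃[ x ] lookup L x ≡ i)

  Golden : Vec ℕ n → Fin n → Set
  Golden L x = ∀ y → x < y → lookup L x <ℕ lookup L y

  GoldenSet : Vec ℕ n → Subset n → Set
  GoldenSet L S = ∀ x → x ∈ S → Golden L x

  private
    better : Vec ℕ n → Fin n → Maybe (Fin n) → Maybe (Fin n)
    better L y nothing  = just y
    better L y (just z) = if ⌊ lookup L y <ℕ? lookup L z ⌋ then just y else just z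

  -- L-successor of v (nothing iff v is maximal)
  succL : Vec ℕ n → Fin n → Maybe (Fin n)
  succL L v =
    foldr (λ y acc → if ⌊ v <? y ⌋ then better L y acc else acc) nothing (allFin n)

  inv1 : Vec ℕ n → Maybe (Fin n)
  inv1 L = foldr (λ y acc → if ⌊ lookup L y ≟ℕ 1 ⌋ then just y else acc) nothing (allFin n)

  -- the chain v, succ v, succ succ v, … (fuel bounds its length; n suffices)
  chainFrom : Vec ℕ n → ℕ → Fin n → List (Fin n)
  chainFrom L zero    v = []
  chainFrom L (suc f) v = v ∷ maybe (chainFrom L f) [] (succL L v)

  promotionChain : Vec ℕ n → List (Fin n)
  promotionChain L = maybe (chainFrom L n) [] (inv1 L)

  ∂ : Vec ℕ n → Vec ℕ n
  ∂ L = tabulate λ x →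
    if ⌊ any? (x ≟F_) (promotionChain L) ⌋
      then maybe (λ w → lookup L w ∸ 1) n (succL L x)
      else lookup L x ∸ 1

  IsMaxGoldenChainAbove : Vec ℕ n → Fin n → Subset n → Set
  IsMaxGoldenChainAbove L b C =
    (∀ x → x ∈ C → b ≤ x) × IsChainOn C × GoldenSet L C ×
    (∀ S → C ⊆ S → (∀ x → x ∈ S → b ≤ x) → IsChainOn S → GoldenSet L S → S ⊆ C)

  GoldenSubtreeBelow : Vec ℕ n → Fin n → Subset n → Set
  GoldenSubtreeBelow L b T =
    IsRootedTreeOn T × GoldenSet L T × (∃[ r ] (RootOf T r × r < b))

  InM : Vec ℕ n → Fin n → Subset n → Set
  InM L b T =
    GoldenSubtreeBelow L b T × (∀ S → T ⊆ S → GoldenSubtreeBelow L b S → S ⊆ T)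

  -- ω_T(x): number of elements on the path from x to the root of T inside T,
  -- i.e. the number of y ∈ T with x ≤ y.
  ω : Subset n → Fin n → ℕ
  ω T x = length (filter (λ y → y ∈? T) (filter (x ≤?_) (allFin n)))

  innerSum : ℕ → Subset n → ℕ
  innerSum k T = sum (map (λ x → 2 ^ (ω T x + k ∸ 2)) (filter (_∈? T) (allFin n)))

-- The preimages of L under ∂ correspond to the L-golden chains S containing the root r = L⁻¹(n):
-- such an S yields the labeling that raises every label off S by one and gives each element of S
-- one more than the label of its predecessor in S (1 to the bottom of S); its promotion chain is
-- exactly S, and ∂ undoes it.  A golden chain through r either lies above the highest branch
-- vertex b, and is then r together with any subset of the other k − 1 elements of C, or its least
-- element x lies below b.  Then x lies in a unique tree T ∈ 𝓜, and the chain is {x, r} together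
-- with any subset of the golden elements strictly between x and r, which are the ω(x) − 1
-- elements of T above x and the k − 1 elements of C other than r.
module Submission where

open import Defs
open import Data.Nat using (ℕ; _+_; _∸_; _^_)
open import Data.Fin using (Fin)
open import Data.Fin.Subset using (Subset; ∣_∣)
open import Data.Vec using (Vec; lookup)
open import Data.List using (List; map)
open import Data.Nat.ListAction using (sum)
open import Data.List.Relation.Unary.Unique.Propositional using (Unique)
open import Data.Product using (_×_)
open import Relation.Binary.PropositionalEquality using (_≡_)
open import Function.Bundles using (_⇔_)

module PromotionPreimages where
  open import Level using (0ℓ)
  open import Data.Nat using (zero; suc; s≤s; z≤n)
    renaming (_≤_ to _≤ℕ_; _<_ to _<ℕ_; _<?_ to _<ℕ?_; _≟_ to _≟ℕ_)
  import Data.Nat.Properties as ℕ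
  open import Data.Bool using (true; false; if_then_else_)
  open import Data.Maybe using (Maybe; just; nothing; maybe)
  open import Data.Fin using (zero; suc) renaming (_≟_ to _≟F_)
  import Data.Fin.Properties
  open import Data.Fin.Subset using (_∈_; _∉_; _⊆_; _∪_; _∩_; ⊤; ⁅_⁆; inside; outside)
  open import Data.Fin.Subset.Properties
    using ( _∈?_; ∈⊤; x∈⁅x⁆; x∈⁅y⁆⇒x≡y; ∣⁅x⁆∣≡1; ⊆-antisym; p⊂q⇒∣p∣<∣q∣
          ; x∈p∪q⁺; x∈p∪q⁻; x∈p∩q⁺; p∩q⊆p; p∩q⊆q; p⊆p∪q; drop-∷-⊆; out⊆; in⊆in )
  open import Data.Vec using ([]; _∷_; tabulate; here; there)
  import Data.Vec.Properties as Vec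
  open import Data.List using ([]; _∷_; _++_; filter; length; allFin; foldr)
  import Data.List.Properties as List
  open import Data.List.Membership.Propositional using () renaming (_∈_ to _∈ᴸ_)
  open import Data.List.Membership.Propositional.Properties
    using (∈-++⁺ˡ; ∈-++⁺ʳ; ∈-++⁻; ∈-map⁺; ∈-map⁻; ∈-filter⁺; ∈-filter⁻; ∈-allFin)
  open import Data.List.Relation.Unary.Any using (here; there; any?)
  import Data.List.Relation.Unary.All as All
  import Data.List.Relation.Unary.All.Properties as AllP
  open import Data.List.Relation.Unary.Unique.Propositional using ([]; _∷_)
  import Data.List.Relation.Unary.Unique.Propositional.Properties as Unique
  open import Data.List.Extrema.Nat
    using (argmin; argmin-sel; f[argmin]≤f[xs]; max; argmax-sel; xs≤max)
  open import Data.Product using (∃; _,_; proj₁; proj₂)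
  open import Data.Sum using (_⊎_; inj₁; inj₂; [_,_])
  import Data.Sum as Sum
  open import Data.Empty using (⊥; ⊥-elim)
  open import Function using (id; _∘_; case_of_; mk⇔; Equivalence)
  open import Relation.Nullary using (¬_; ¬?; Dec; yes; no; does; contradiction)
  open import Relation.Nullary.Decidable using (⌊_⌋; dec-true; dec-false; _×-dec_; _→-dec_)
  open import Relation.Unary using (Pred; Decidable)
  open import Relation.Unary.Properties using (_∩?_)
  open import Relation.Binary using (IsPartialOrder)
  open import Relation.Binary.Construct.Closure.ReflexiveTransitive using (Star; ε; _◅_)
  open import Relation.Binary.PropositionalEquality
    using (_≢_; refl; sym; trans; cong; cong₂; subst; module ≡-Reasoning)

  open Equivalence using (to; from)

  private
    variable
      A B : Set
      n : ℕ

  module _ {P Q : A → Set} where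

    HasCard-cong : ∀ {m} → (∀ a → P a ⇔ Q a) → HasCard P m → HasCard Q m
    HasCard-cong P⇔Q (xs , u , ∈⇔ , len) =
      xs , u , (λ a → mk⇔ (to (P⇔Q a) ∘ to (∈⇔ a)) (from (∈⇔ a) ∘ from (P⇔Q a))) , len

    HasCard-⊎ : ∀ {m k} → (∀ a → P a → Q a → ⊥) →
                HasCard P m → HasCard Q k → HasCard (λ a → P a ⊎ Q a) (m + k)
    HasCard-⊎ disj (xs , u , ∈xs , lx) (ys , v , ∈ys , ly) =
      xs ++ ys ,
      Unique.++⁺ u v (λ (i , j) → disj _ (to (∈xs _) i) (to (∈ys _) j)) ,
      (λ a → mk⇔ (Sum.map (to (∈xs a)) (to (∈ys a)) ∘ ∈-++⁻ xs)
                 [ ∈-++⁺ˡ ∘ from (∈xs a) , ∈-++⁺ʳ xs ∘ from (∈ys a) ]) ,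
      trans (List.length-++ xs) (cong₂ _+_ lx ly)

  HasCard-⊥ : HasCard {A} (λ _ → ⊥) 0
  HasCard-⊥ = [] , [] , (λ _ → mk⇔ (λ ()) ⊥-elim) , refl

  Unique-map⁺ : ∀ (f : A → B) {xs} →
                (∀ {a a′} → a ∈ᴸ xs → a′ ∈ᴸ xs → f a ≡ f a′ → a ≡ a′) →
                Unique xs → Unique (map f xs)
  Unique-map⁺ f inj [] = []
  Unique-map⁺ f {x ∷ xs} inj (x∉ ∷ u) =
    AllP.map⁺ (All.tabulate (λ {a} a∈ fx≡fa → All.lookup x∉ a∈ (inj (here refl) (there a∈) fx≡fa))) ∷
    Unique-map⁺ f (λ i j → inj (there i) (there j)) u

  HasCard-image : ∀ {P : A → Set} {m} (f : A → B) →
                  (∀ {a a′} → P a → P a′ → f a ≡ f a′ → a ≡ a′) →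
                  HasCard P m → HasCard (λ y → ∃ λ a → P a × f a ≡ y) m
  HasCard-image f inj (xs , u , ∈⇔ , len) =
    map f xs ,
    Unique-map⁺ f (λ i j → inj (to (∈⇔ _) i) (to (∈⇔ _) j)) u ,
    (λ y → mk⇔ (λ i → let a , a∈ , y≡ = ∈-map⁻ f i in a , to (∈⇔ a) a∈ , sym y≡)
               (λ { (a , pa , refl) → ∈-map⁺ f (from (∈⇔ a) pa) })) ,
    trans (List.length-map f xs) len

  HasCard-≡ : ∀ {P : A → Set} {m k} → m ≡ k → HasCard P m → HasCard P k
  HasCard-≡ refl = id

  HasCard-Σ : ∀ {I : Set} (is : List I) → Unique is → (m : I → ℕ) (P : I → A → Set) →
              (∀ {i j a} → i ∈ᴸ is → j ∈ᴸ is → P i a → P j a → i ≡ j) →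
              (∀ {i} → i ∈ᴸ is → HasCard (P i) (m i)) →
              HasCard (λ a → ∃ λ i → i ∈ᴸ is × P i a) (sum (map m is))
  HasCard-Σ [] _ m P _ _ = HasCard-cong (λ _ → mk⇔ ⊥-elim λ ()) HasCard-⊥
  HasCard-Σ (i ∷ is) (i∉ ∷ u) m P disj card =
    HasCard-cong (λ a → mk⇔ [ (λ p → i , here refl , p) , (λ (j , j∈ , p) → j , there j∈ , p) ]
                            (λ { (_ , here refl , p) → inj₁ p ; (j , there j∈ , p) → inj₂ (j , j∈ , p) }))
      (HasCard-⊎ (λ a p (j , j∈ , q) → All.lookup i∉ j∈ (disj (here refl) (there j∈) p q))
                 (card (here refl))
                 (HasCard-Σ is u m P (λ i∈ j∈ → disj (there i∈) (there j∈)) (card ∘ there)))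

  2^-suc : ∀ k → 2 ^ k + 2 ^ k ≡ 2 ^ suc k
  2^-suc k = cong (2 ^ k +_) (sym (ℕ.+-identityʳ (2 ^ k)))

  HasCard-⊆ : (S : Subset n) → HasCard (_⊆ S) (2 ^ ∣ S ∣)
  HasCard-⊆ [] = [] ∷ [] , All.[] ∷ [] , (λ { [] → mk⇔ (λ _ ()) (λ _ → here refl) }) , refl
  HasCard-⊆ (inside ∷ S) =
    HasCard-cong char
      (HasCard-≡ (2^-suc ∣ S ∣)
        (HasCard-⊎ (λ { _ (_ , _ , refl) (_ , _ , ()) }) (consed inside) (consed outside)))
    where
    consed : ∀ s → HasCard (λ V → ∃ λ U → U ⊆ S × s ∷ U ≡ V) (2 ^ ∣ S ∣)
    consed s = HasCard-image (s ∷_) (λ _ _ → Vec.∷-injectiveʳ) (HasCard-⊆ S)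
    char : ∀ V → ((∃ λ U → U ⊆ S × inside ∷ U ≡ V) ⊎ (∃ λ U → U ⊆ S × outside ∷ U ≡ V)) ⇔
                 V ⊆ inside ∷ S
    char (inside ∷ V) = mk⇔ (λ { (inj₁ (_ , U⊆S , refl)) → in⊆in U⊆S })
                            (λ (V⊆ : inside ∷ V ⊆ inside ∷ S) → inj₁ (V , (λ {_} → drop-∷-⊆ V⊆) , refl))
    char (outside ∷ V) = mk⇔ (λ { (inj₂ (_ , U⊆S , refl)) → out⊆ U⊆S })
                             (λ (V⊆ : outside ∷ V ⊆ inside ∷ S) → inj₂ (V , (λ {_} → drop-∷-⊆ V⊆) , refl))
  HasCard-⊆ (outside ∷ S) =
    HasCard-cong char (HasCard-image (outside ∷_) (λ _ _ → Vec.∷-injectiveʳ) (HasCard-⊆ S))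
    where
    char : ∀ V → (∃ λ U → U ⊆ S × outside ∷ U ≡ V) ⇔ V ⊆ outside ∷ S
    char (inside ∷ V) = mk⇔ (λ { (_ , _ , ()) })
                            (λ (V⊆ : inside ∷ V ⊆ outside ∷ S) → contradiction (V⊆ here) λ ())
    char (outside ∷ V) = mk⇔ (λ { (_ , U⊆S , refl) → out⊆ U⊆S })
                             (λ (V⊆ : outside ∷ V ⊆ outside ∷ S) → V , (λ {_} → drop-∷-⊆ V⊆) , refl)

  x∈p⇒⁅x⁆⊆p : ∀ {x} {p : Subset n} → x ∈ p → ⁅ x ⁆ ⊆ p
  x∈p⇒⁅x⁆⊆p {x = x} x∈p y∈⁅x⁆ = subst (_∈ _) (sym (x∈⁅y⁆⇒x≡y x y∈⁅x⁆)) x∈p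

  ∪-lub : ∀ {p q s : Subset n} → p ⊆ s → q ⊆ s → p ∪ q ⊆ s
  ∪-lub {p = p} {q} p⊆s q⊆s x∈ = [ p⊆s , q⊆s ] (x∈p∪q⁻ p q x∈)

  Disjoint : Subset n → Subset n → Set
  Disjoint p q = ∀ {x} → x ∈ p → x ∈ q → ⊥

  ∪-cancelˡ : ∀ {F U V : Subset n} → Disjoint F U → Disjoint F V → F ∪ U ≡ F ∪ V → U ≡ V
  ∪-cancelˡ F#U F#V eq = ⊆-antisym (⊆-cancel F#U eq) (⊆-cancel F#V (sym eq))
    where
    ⊆-cancel : ∀ {F U V : Subset n} → Disjoint F U → F ∪ U ≡ F ∪ V → U ⊆ V
    ⊆-cancel {F = F} {U} {V} F#U eq {x} x∈U with x∈p∪q⁻ F V (subst (x ∈_) eq (x∈p∪q⁺ (inj₂ x∈U)))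
    ... | inj₁ x∈F = ⊥-elim (F#U x∈F x∈U)
    ... | inj₂ x∈V = x∈V

  -- The sets between F and F ∪ S are exactly the F ∪ U with U ⊆ S.
  HasCard-interval : (F S : Subset n) → Disjoint F S →
                     HasCard (λ X → F ⊆ X × X ⊆ F ∪ S) (2 ^ ∣ S ∣)
  HasCard-interval F S F#S = HasCard-cong char (HasCard-image (F ∪_) cancel (HasCard-⊆ S))
    where
    cancel : ∀ {U V} → U ⊆ S → V ⊆ S → F ∪ U ≡ F ∪ V → U ≡ V
    cancel U⊆S V⊆S = ∪-cancelˡ (λ x∈F → F#S x∈F ∘ U⊆S) (λ x∈F → F#S x∈F ∘ V⊆S)
    char : ∀ X → (∃ λ U → U ⊆ S × F ∪ U ≡ X) ⇔ (F ⊆ X × X ⊆ F ∪ S)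
    char X = mk⇔ (λ { (U , U⊆S , refl) → p⊆p∪q U , x∈p∪q⁺ ∘ Sum.map₂ U⊆S ∘ x∈p∪q⁻ F U })
                 (λ (F⊆X , X⊆) → X ∩ S , p∩q⊆q X S , ⊆-antisym (sup F⊆X) (inf X⊆))
      where
      sup : F ⊆ X → F ∪ (X ∩ S) ⊆ X
      sup F⊆X x∈ = [ F⊆X , p∩q⊆p X S ] (x∈p∪q⁻ F (X ∩ S) x∈)
      inf : X ⊆ F ∪ S → X ⊆ F ∪ (X ∩ S)
      inf X⊆ x∈X = x∈p∪q⁺ (Sum.map₂ (λ x∈S → x∈p∩q⁺ (x∈X , x∈S)) (x∈p∪q⁻ F S (X⊆ x∈X)))

  ∣p∪q∣≡∣p∣+∣q∣ : (p q : Subset n) → Disjoint p q → ∣ p ∪ q ∣ ≡ ∣ p ∣ + ∣ q ∣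
  ∣p∪q∣≡∣p∣+∣q∣ [] [] _ = refl
  ∣p∪q∣≡∣p∣+∣q∣ (inside ∷ p) (inside ∷ q) p#q = ⊥-elim (p#q here here)
  ∣p∪q∣≡∣p∣+∣q∣ (inside ∷ p) (outside ∷ q) p#q =
    cong suc (∣p∪q∣≡∣p∣+∣q∣ p q λ x∈p x∈q → p#q (there x∈p) (there x∈q))
  ∣p∪q∣≡∣p∣+∣q∣ (outside ∷ p) (inside ∷ q) p#q =
    trans (cong suc (∣p∪q∣≡∣p∣+∣q∣ p q λ x∈p x∈q → p#q (there x∈p) (there x∈q)))
          (sym (ℕ.+-suc ∣ p ∣ ∣ q ∣))
  ∣p∪q∣≡∣p∣+∣q∣ (outside ∷ p) (outside ∷ q) p#q =
    ∣p∪q∣≡∣p∣+∣q∣ p q λ x∈p x∈q → p#q (there x∈p) (there x∈q)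

  module _ {P : Pred (Fin n) 0ℓ} (P? : Decidable P) where

    subsetOf : Subset n
    subsetOf = tabulate (does ∘ P?)

    ∈-subsetOf⁺ : ∀ {x} → P x → x ∈ subsetOf
    ∈-subsetOf⁺ {x} px = Vec.lookup⇒[]= x subsetOf (trans (Vec.lookup∘tabulate (does ∘ P?) x) (dec-true (P? x) px))

    ∈-subsetOf⁻ : ∀ {x} → x ∈ subsetOf → P x
    ∈-subsetOf⁻ {x} x∈ with P? x | trans (sym (Vec.lookup∘tabulate (does ∘ P?) x)) (Vec.[]=⇒lookup x∈)
    ... | yes px | _ = px
    ... | no _ | ()

  length-filter-tabulate : ∀ {P : Pred A 0ℓ} (P? : Decidable P) (f : Fin n → A) →
                           length (filter P? (Data.List.tabulate f)) ≡ ∣ subsetOf (P? ∘ f) ∣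
  length-filter-tabulate {n = zero} P? f = refl
  length-filter-tabulate {n = suc n} P? f with does (P? (f zero))
  ... | true = cong suc (length-filter-tabulate P? (f ∘ suc))
  ... | false = length-filter-tabulate P? (f ∘ suc)

  filter-filter : ∀ {P Q : Pred A 0ℓ} (P? : Decidable P) (Q? : Decidable Q) xs →
                  filter Q? (filter P? xs) ≡ filter (P? ∩? Q?) xs
  filter-filter P? Q? [] = refl
  filter-filter P? Q? (x ∷ xs) with does (P? x)
  ... | false = filter-filter P? Q? xs
  ... | true with does (Q? x)
  ...   | true = cong (x ∷_) (filter-filter P? Q? xs)
  ...   | false = filter-filter P? Q? xs

  opaque
    ∃-minimiser : (f : Fin n → ℕ) {P : Pred (Fin n) 0ℓ} → Decidable P → ∃ P →
                  ∃ λ m → P m × (∀ y → P y → f m ≤ℕ f y)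
    ∃-minimiser {n} f {P} P? (a , pa) =
      m , pm , λ y py → All.lookup (f[argmin]≤f[xs] a xs) (∈-filter⁺ P? (∈-allFin y) py)
      where
      xs : List (Fin n)
      xs = filter P? (allFin n)
      m : Fin n
      m = argmin f a xs
      pm : P m
      pm with argmin-sel f a xs
      ... | inj₁ m≡a = subst P (sym m≡a) pa
      ... | inj₂ m∈xs = proj₂ (∈-filter⁻ P? {xs = allFin n} m∈xs)

  module PosetProperties {n} (P : FinPoset n) where
    open FinPoset P
    open IsPartialOrder isPartialOrder public
      using (antisym) renaming (refl to ≤-refl; reflexive to ≤-reflexive; trans to ≤-trans)

    <-irrefl : ∀ {x} → ¬ x < x
    <-irrefl (_ , x≢x) = x≢x refl

    <-asym : ∀ {x y} → x < y → ¬ y ≤ x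
    <-asym (x≤y , x≢y) y≤x = x≢y (antisym x≤y y≤x)

    <-≤-trans : ∀ {x y z} → x < y → y ≤ z → x < z
    <-≤-trans (x≤y , x≢y) y≤z = ≤-trans x≤y y≤z , λ { refl → x≢y (antisym x≤y y≤z) }

    ≤-<-trans : ∀ {x y z} → x ≤ y → y < z → x < z
    ≤-<-trans x≤y (y≤z , y≢z) = ≤-trans x≤y y≤z , λ { refl → y≢z (antisym y≤z x≤y) }

    <-trans : ∀ {x y z} → x < y → y < z → x < z
    <-trans x<y (y≤z , _) = <-≤-trans x<y y≤z

    ≤⇒≡⊎< : ∀ {x y} → x ≤ y → x ≡ y ⊎ x < y
    ≤⇒≡⊎< {x} {y} x≤y with x ≟F y
    ... | yes x≡y = inj₁ x≡y
    ... | no x≢y = inj₂ (x≤y , x≢y)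

    ≤∧≮⇒≡ : ∀ {x y} → x ≤ y → ¬ x < y → x ≡ y
    ≤∧≮⇒≡ {x} {y} x≤y x≮y with x ≟F y
    ... | yes x≡y = x≡y
    ... | no x≢y = ⊥-elim (x≮y (x≤y , x≢y))

    strictlyBelow strictlyAbove : Fin n → Subset n
    strictlyBelow z = subsetOf (_<? z)
    strictlyAbove z = subsetOf (z <?_)

    ∣strictlyBelow∣-mono : ∀ {w z} → w < z → ∣ strictlyBelow w ∣ <ℕ ∣ strictlyBelow z ∣
    ∣strictlyBelow∣-mono {w} {z} w<z = p⊂q⇒∣p∣<∣q∣
      ( (λ y∈ → ∈-subsetOf⁺ (_<? z) (<-trans (∈-subsetOf⁻ (_<? w) y∈) w<z))
      , w , ∈-subsetOf⁺ (_<? z) w<z , <-irrefl ∘ ∈-subsetOf⁻ (_<? w) )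

    ∣strictlyAbove∣-mono : ∀ {w z} → w < z → ∣ strictlyAbove z ∣ <ℕ ∣ strictlyAbove w ∣
    ∣strictlyAbove∣-mono {w} {z} w<z = p⊂q⇒∣p∣<∣q∣
      ( (λ y∈ → ∈-subsetOf⁺ (w <?_) (<-trans w<z (∈-subsetOf⁻ (z <?_) y∈)))
      , z , ∈-subsetOf⁺ (w <?_) w<z , <-irrefl ∘ ∈-subsetOf⁻ (z <?_) )

    ∃-minimal : ∀ {Q : Pred (Fin n) 0ℓ} → Decidable Q → ∃ Q → ∃ λ m → Q m × ∀ {y} → Q y → ¬ y < m
    ∃-minimal Q? q with ∃-minimiser (λ z → ∣ strictlyBelow z ∣) Q? q
    ... | m , qm , least = m , qm , λ qy y<m → ℕ.<⇒≱ (∣strictlyBelow∣-mono y<m) (least _ qy)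

    ∃-maximal : ∀ {Q : Pred (Fin n) 0ℓ} → Decidable Q → ∃ Q → ∃ λ m → Q m × ∀ {y} → Q y → ¬ m < y
    ∃-maximal Q? q with ∃-minimiser (λ z → ∣ strictlyAbove z ∣) Q? q
    ... | m , qm , least = m , qm , λ qy m<y → ℕ.<⇒≱ (∣strictlyAbove∣-mono m<y) (least _ qy)

    <⇒⋖≤ : ∀ {x y} → x < y → ∃ λ c → x ⋖ c × c ≤ y
    <⇒⋖≤ {x} {y} x<y with ∃-minimal (λ w → x <? w ×-dec w ≤? y) (y , x<y , ≤-refl)
    ... | c , (x<c , c≤y) , minimal =
      c , (x<c , λ z x<z z<c → minimal (x<z , ≤-trans (proj₁ z<c) c≤y) z<c) , c≤y

    <⇒≤⋖ : ∀ {x y} → x < y → ∃ λ c → x ≤ c × c ⋖ y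
    <⇒≤⋖ {x} {y} x<y with ∃-maximal (λ w → x ≤? w ×-dec w <? y) (x , ≤-refl , x<y)
    ... | c , (x≤c , c<y) , maximal =
      c , x≤c , (c<y , λ z c<z z<y → maximal (≤-trans x≤c (proj₁ c<z) , z<y) c<z)

    strictlyAboveIn : Subset n → Fin n → Subset n
    strictlyAboveIn T x = subsetOf (λ y → y ∈? T ×-dec x <? y)

    ∈strictlyAboveIn⁺ : ∀ {T x y} → y ∈ T × x < y → y ∈ strictlyAboveIn T x
    ∈strictlyAboveIn⁺ {T} {x} = ∈-subsetOf⁺ (λ y → y ∈? T ×-dec x <? y)

    ∈strictlyAboveIn⁻ : ∀ {T x y} → y ∈ strictlyAboveIn T x → y ∈ T × x < y
    ∈strictlyAboveIn⁻ {T} {x} = ∈-subsetOf⁻ (λ y → y ∈? T ×-dec x <? y)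

    ω≡1+∣strictlyAboveIn∣ : ∀ {T x} → x ∈ T → ω T x ≡ suc ∣ strictlyAboveIn T x ∣
    ω≡1+∣strictlyAboveIn∣ {T} {x} x∈T = begin
      ω T x
        ≡⟨ cong length (filter-filter (x ≤?_) (_∈? T) (allFin n)) ⟩
      length (filter ((x ≤?_) ∩? (_∈? T)) (allFin n))
        ≡⟨ length-filter-tabulate ((x ≤?_) ∩? (_∈? T)) id ⟩
      ∣ subsetOf ((x ≤?_) ∩? (_∈? T)) ∣
        ≡⟨ cong ∣_∣ (⊆-antisym split join) ⟩
      ∣ ⁅ x ⁆ ∪ strictlyAboveIn T x ∣
        ≡⟨ ∣p∪q∣≡∣p∣+∣q∣ ⁅ x ⁆ _ (λ y∈⁅x⁆ y∈ → <-irrefl (subst (x <_) (x∈⁅y⁆⇒x≡y x y∈⁅x⁆)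
                                                            (proj₂ (∈strictlyAboveIn⁻ y∈)))) ⟩
      ∣ ⁅ x ⁆ ∣ + ∣ strictlyAboveIn T x ∣
        ≡⟨ cong (_+ ∣ strictlyAboveIn T x ∣) (∣⁅x⁆∣≡1 x) ⟩
      suc ∣ strictlyAboveIn T x ∣ ∎
      where
      open ≡-Reasoning
      split : subsetOf ((x ≤?_) ∩? (_∈? T)) ⊆ ⁅ x ⁆ ∪ strictlyAboveIn T x
      split {y} y∈ with ∈-subsetOf⁻ ((x ≤?_) ∩? (_∈? T)) y∈
      ... | x≤y , y∈T with ≤⇒≡⊎< x≤y
      ...   | inj₁ refl = x∈p∪q⁺ (inj₁ (x∈⁅x⁆ x))
      ...   | inj₂ x<y = x∈p∪q⁺ (inj₂ (∈strictlyAboveIn⁺ (y∈T , x<y)))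
      join : ⁅ x ⁆ ∪ strictlyAboveIn T x ⊆ subsetOf ((x ≤?_) ∩? (_∈? T))
      join {y} y∈ with x∈p∪q⁻ ⁅ x ⁆ _ y∈
      ... | inj₁ y∈⁅x⁆ rewrite x∈⁅y⁆⇒x≡y x y∈⁅x⁆ =
        ∈-subsetOf⁺ ((x ≤?_) ∩? (_∈? T)) (≤-refl , x∈T)
      ... | inj₂ y∈above with ∈strictlyAboveIn⁻ y∈above
      ...   | y∈T , x<y = ∈-subsetOf⁺ ((x ≤?_) ∩? (_∈? T)) (proj₁ x<y , y∈T)

  module RootedTreeProperties {n} (P : FinPoset n) (tree : FinPoset.IsRootedTreePoset P) where
    open FinPoset P
    open PosetProperties P

    ⋖-unique : ∀ {x y z} → x ⋖ y → x ⋖ z → y ≡ z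
    ⋖-unique (x<y , ⋖y) (x<z , ⋖z) =
      proj₂ tree _ _ _ (∈⊤ , ∈⊤ , x<y , λ w _ → ⋖y w) (∈⊤ , ∈⊤ , x<z , λ w _ → ⋖z w)

    -- The first steps from x towards y and towards z are the same cover; recurse from it.
    upperSet-total : ∀ {x y z} → x ≤ y → x ≤ z → y ≤ z ⊎ z ≤ y
    upperSet-total {x} = go (suc ∣ strictlyAbove x ∣) ℕ.≤-refl
      where
      go : ∀ fuel {x y z} → ∣ strictlyAbove x ∣ <ℕ fuel → x ≤ y → x ≤ z → y ≤ z ⊎ z ≤ y
      go (suc fuel) bound x≤y x≤z with ≤⇒≡⊎< x≤y | ≤⇒≡⊎< x≤z
      ... | inj₁ refl | _ = inj₁ x≤z
      ... | inj₂ _ | inj₁ refl = inj₂ x≤y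
      ... | inj₂ x<y | inj₂ x<z with <⇒⋖≤ x<y | <⇒⋖≤ x<z
      ... | c , x⋖c , c≤y | c′ , x⋖c′ , c′≤z rewrite ⋖-unique x⋖c′ x⋖c =
        go fuel (ℕ.<-≤-trans (∣strictlyAbove∣-mono (proj₁ x⋖c)) (ℕ.≤-pred bound)) c≤y c′≤z

  module HighestBranchProperties {n} (P : FinPoset n) (tree : FinPoset.IsRootedTreePoset P)
                                 (b : Fin n) (highest : FinPoset.IsHighestBranch P b) where
    open FinPoset P
    open PosetProperties P
    open RootedTreeProperties P tree

    ComparableToB : Fin n → Set
    ComparableToB x = b ≤ x ⊎ x ≤ b

    -- Otherwise a least common upper bound of b and c covers two distinct elements: a branch vertex above b.
    commonUpperBound⇒comparable : ∀ {a c} → b ≤ a → c ≤ a → ComparableToB c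
    commonUpperBound⇒comparable {a} {c} b≤a c≤a
      with ∃-minimal (λ w → b ≤? w ×-dec c ≤? w) (a , b≤a , c≤a)
    ... | w , (b≤w , c≤w) , minimal with ≤⇒≡⊎< b≤w | ≤⇒≡⊎< c≤w
    ... | inj₁ refl | _ = inj₂ c≤w
    ... | inj₂ _ | inj₁ refl = inj₁ b≤w
    ... | inj₂ b<w | inj₂ c<w with <⇒≤⋖ b<w | <⇒≤⋖ c<w
    ... | p , b≤p , p⋖w | q , c≤q , q⋖w =
      ⊥-elim (<-asym b<w (proj₂ highest w (p , q , p≢q , p⋖w , q⋖w)))
      where
      p≢q : p ≢ q
      p≢q refl = minimal (b≤p , c≤q) (proj₁ p⋖w)

    comparable-step : ∀ {x y} → x ≤ y ⊎ y ≤ x → ComparableToB x → ComparableToB y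
    comparable-step (inj₁ x≤y) (inj₁ b≤x) = inj₁ (≤-trans b≤x x≤y)
    comparable-step (inj₂ y≤x) (inj₁ b≤x) = commonUpperBound⇒comparable b≤x y≤x
    comparable-step (inj₁ x≤y) (inj₂ x≤b) = upperSet-total x≤b x≤y
    comparable-step (inj₂ y≤x) (inj₂ x≤b) = inj₂ (≤-trans y≤x x≤b)

    comparableToB : ∀ x → ComparableToB x
    comparableToB x = along (proj₂ (proj₁ tree) b x ∈⊤ ∈⊤) (inj₁ ≤-refl)
      where
      along : ∀ {y z} → Star (λ u v → u ∈ ⊤ × v ∈ ⊤ × (u ≤ v ⊎ v ≤ u)) y z →
              ComparableToB y → ComparableToB z
      along ε = id
      along ((_ , _ , y~u) ◅ path) = along path ∘ comparable-step y~u

  module Promotion {n} (P : FinPoset n) (L′ : Vec ℕ n) where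
    open FinPoset P
    open PosetProperties P

    ℓ : Fin n → ℕ
    ℓ = lookup L′

    data LeastLabelAbove (v : Fin n) (xs : List (Fin n)) : Maybe (Fin n) → Set where
      none : (∀ {y} → y ∈ᴸ xs → ¬ v < y) → LeastLabelAbove v xs nothing
      some : ∀ {y} → v < y → (∀ {z} → z ∈ᴸ xs → v < z → ℓ y ≤ℕ ℓ z) → LeastLabelAbove v xs (just y)

    private
      keepLeast : Fin n → Maybe (Fin n) → Maybe (Fin n)
      keepLeast y nothing  = just y
      keepLeast y (just z) = if ⌊ ℓ y <ℕ? ℓ z ⌋ then just y else just z

      candidate : Fin n → Fin n → Maybe (Fin n) → Maybe (Fin n)
      candidate v y acc = if ⌊ v <? y ⌋ then keepLeast y acc else acc

      leastLabelAbove : ∀ v (F : Fin n → Maybe (Fin n) → Maybe (Fin n)) →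
                        (∀ y acc → F y acc ≡ candidate v y acc) →
                        ∀ xs → LeastLabelAbove v xs (foldr F nothing xs)
      leastLabelAbove v F F≗ [] = none λ ()
      leastLabelAbove v F F≗ (x ∷ xs) rewrite F≗ x (foldr F nothing xs)
        with v <? x | foldr F nothing xs | leastLabelAbove v F F≗ xs
      ... | no v≮x | _ | none above = none λ { (here refl) → v≮x ; (there i) → above i }
      ... | no v≮x | _ | some v<y least =
        some v<y λ { (here refl) v<x → ⊥-elim (v≮x v<x) ; (there i) → least i }
      ... | yes v<x | _ | none above =
        some v<x λ { (here refl) _ → ℕ.≤-refl ; (there i) v<z → ⊥-elim (above i v<z) }
      ... | yes v<x | _ | some {y} v<y least with ℓ x <ℕ? ℓ y
      ...   | yes ℓx<ℓy =
        some v<x λ { (here refl) _ → ℕ.≤-refl ; (there i) v<z → ℕ.≤-trans (ℕ.<⇒≤ ℓx<ℓy) (least i v<z) }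
      ...   | no ℓx≮ℓy = some v<y λ { (here refl) _ → ℕ.≮⇒≥ ℓx≮ℓy ; (there i) → least i }

    -- succL uses the private helper better, hence the detour through any F agreeing with candidate.
    succL-spec : ∀ v → LeastLabelAbove v (allFin n) (succL L′ v)
    succL-spec v = leastLabelAbove v _ (λ { _ nothing → refl ; _ (just _) → refl }) (allFin n)

    succL-maximal : ∀ {v} → succL L′ v ≡ nothing → ∀ {y} → ¬ v < y
    succL-maximal {v} eq with succL L′ v | succL-spec v
    succL-maximal refl | nothing | none above = above (∈-allFin _)

    succL-least : ∀ {v y} → succL L′ v ≡ just y → v < y × (∀ {z} → v < z → ℓ y ≤ℕ ℓ z)
    succL-least {v} eq with succL L′ v | succL-spec v
    succL-least refl | just _ | some v<y least = v<y , least (∈-allFin _)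

    opaque
      inv1-spec : ∀ {a} → ℓ a ≡ 1 → ∃ λ v → inv1 L′ ≡ just v × ℓ v ≡ 1
      inv1-spec {a} ℓa≡1 = go (allFin n) (∈-allFin a)
        where
        go : ∀ xs → a ∈ᴸ xs →
             ∃ λ v → foldr (λ y acc → if ⌊ ℓ y ≟ℕ 1 ⌋ then just y else acc) nothing xs ≡ just v ×
                     ℓ v ≡ 1
        go (x ∷ xs) a∈ with ℓ x ≟ℕ 1 | a∈
        ... | yes ℓx≡1 | _ = x , refl , ℓx≡1
        ... | no ℓx≢1 | here refl = ⊥-elim (ℓx≢1 ℓa≡1)
        ... | no _ | there a∈xs = go xs a∈xs

    private
      ∈-chainTail : ∀ {s f} m → s ∈ᴸ maybe (chainFrom L′ f) [] m →
                    ∃ λ y → m ≡ just y × s ∈ᴸ chainFrom L′ f y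
      ∈-chainTail (just y) s∈ = y , refl , s∈

      ∈-chainTail⁺ : ∀ {s f v y} → succL L′ v ≡ just y → s ∈ᴸ chainFrom L′ f y →
                     s ∈ᴸ chainFrom L′ (suc f) v
      ∈-chainTail⁺ {s} {f} eq s∈ = there (subst (λ m → s ∈ᴸ maybe (chainFrom L′ f) [] m) (sym eq) s∈)

      succL-unique : ∀ {v y y′} → succL L′ v ≡ just y → succL L′ v ≡ just y′ → y ≡ y′
      succL-unique eq eq′ with refl ← trans (sym eq) eq′ = refl

    chainFrom-≥ : ∀ f v {s} → s ∈ᴸ chainFrom L′ f v → v ≤ s
    chainFrom-≥ (suc f) v (here refl) = ≤-refl
    chainFrom-≥ (suc f) v (there s∈) with ∈-chainTail (succL L′ v) s∈
    ... | y , eq , s∈′ = ≤-trans (proj₁ (proj₁ (succL-least eq))) (chainFrom-≥ f y s∈′)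

    chainFrom-total : ∀ f v {s t} → s ∈ᴸ chainFrom L′ f v → t ∈ᴸ chainFrom L′ f v → s ≤ t ⊎ t ≤ s
    chainFrom-total (suc f) v (here refl) t∈ = inj₁ (chainFrom-≥ (suc f) v t∈)
    chainFrom-total (suc f) v (there s∈) (here refl) = inj₂ (chainFrom-≥ (suc f) v (there s∈))
    chainFrom-total (suc f) v (there s∈) (there t∈)
      with ∈-chainTail (succL L′ v) s∈ | ∈-chainTail (succL L′ v) t∈
    ... | y , eq , s∈′ | y′ , eq′ , t∈′ with refl ← succL-unique eq eq′ = chainFrom-total f y s∈′ t∈′

    chainFrom-noGap : ∀ f v {p s x} → p ∈ᴸ chainFrom L′ f v → s ∈ᴸ chainFrom L′ f v →
                      succL L′ p ≡ just x → p < s → ¬ s < x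
    chainFrom-noGap (suc f) v (here refl) (here refl) _ p<s = ⊥-elim (<-irrefl p<s)
    chainFrom-noGap (suc f) v (here refl) (there s∈) eq _ s<x with ∈-chainTail (succL L′ v) s∈
    ... | y , eq′ , s∈′ with refl ← succL-unique eq eq′ = <-asym s<x (chainFrom-≥ f y s∈′)
    chainFrom-noGap (suc f) v (there p∈) (here refl) _ p<s _ with ∈-chainTail (succL L′ v) p∈
    ... | y , eq′ , p∈′ = <-asym p<s (proj₁ (<-≤-trans (proj₁ (succL-least eq′)) (chainFrom-≥ f y p∈′)))
    chainFrom-noGap (suc f) v (there p∈) (there s∈) eq
      with ∈-chainTail (succL L′ v) p∈ | ∈-chainTail (succL L′ v) s∈
    ... | y , eq₁ , p∈′ | y′ , eq₂ , s∈′ with refl ← succL-unique eq₁ eq₂ =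
      chainFrom-noGap f y p∈′ s∈′ eq

    chainFrom-predecessor : ∀ f v {x} → x ∈ᴸ chainFrom L′ f v →
                            x ≡ v ⊎ ∃ λ p → p ∈ᴸ chainFrom L′ f v × succL L′ p ≡ just x
    chainFrom-predecessor (suc f) v (here refl) = inj₁ refl
    chainFrom-predecessor (suc f) v (there x∈) with ∈-chainTail (succL L′ v) x∈
    ... | y , eq , x∈′ with chainFrom-predecessor f y x∈′
    ...   | inj₁ refl = inj₂ (v , here refl , eq)
    ...   | inj₂ (p , p∈ , eq′) = inj₂ (p , ∈-chainTail⁺ eq p∈ , eq′)

  module GoldenRootChains {n} (P : FinPoset n) (tree : FinPoset.IsRootedTreePoset P)
                          (L : Vec ℕ n) (isLabeling : FinPoset.IsLabeling P L)
                          (b : Fin n) (highest : FinPoset.IsHighestBranch P b)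
                          (topMaximal : ∀ x → lookup L x ≡ n → FinPoset.IsMaximal P x) where
    open FinPoset P
    open PosetProperties P
    open RootedTreeProperties P tree
    open HighestBranchProperties P tree b highest

    label : Fin n → ℕ
    label = lookup L

    label-positive : ∀ x → 1 ≤ℕ label x
    label-positive x = proj₁ (proj₁ isLabeling x)

    label-≤n : ∀ x → label x ≤ℕ n
    label-≤n x = proj₂ (proj₁ isLabeling x)

    label-injective : ∀ {x y} → label x ≡ label y → x ≡ y
    label-injective = proj₁ (proj₂ isLabeling) _ _

    label-surjective : ∀ {i} → 1 ≤ℕ i → i ≤ℕ n → ∃ λ x → label x ≡ i
    label-surjective = proj₂ (proj₂ isLabeling) _

    1≤n : 1 ≤ℕ n
    1≤n = ℕ.≤-trans (label-positive b) (label-≤n b)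

    -- r = L⁻¹(n); the hypothesis on L makes it maximal, hence the root of the tree.
    r : Fin n
    r = proj₁ (label-surjective 1≤n ℕ.≤-refl)

    label-r : label r ≡ n
    label-r = proj₂ (label-surjective 1≤n ℕ.≤-refl)

    r-maximal : ∀ {y} → ¬ r < y
    r-maximal (r≤y , r≢y) = r≢y (topMaximal r label-r _ r≤y)

    private
      ≤-maximal : ∀ {x} → x ≤ r ⊎ r ≤ x → x ≤ r
      ≤-maximal (inj₁ x≤r) = x≤r
      ≤-maximal (inj₂ r≤x) = subst (_≤ r) (topMaximal r label-r _ r≤x) ≤-refl

    b≤r : b ≤ r
    b≤r = ≤-maximal (comparableToB r)

    ≤r : ∀ x → x ≤ r
    ≤r x with comparableToB x
    ... | inj₁ b≤x = ≤-maximal (upperSet-total b≤x b≤r)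
    ... | inj₂ x≤b = ≤-trans x≤b b≤r

    ≢r⇒<r : ∀ {x} → x ≢ r → x < r
    ≢r⇒<r = ≤r _ ,_

    golden? : ∀ x → Dec (Golden L x)
    golden? x = Data.Fin.Properties.all? λ y → (x <? y) →-dec (label x <ℕ? label y)

    r-golden : Golden L r
    r-golden _ r<y = ⊥-elim (r-maximal r<y)

    golden-≤ : ∀ {s z} → Golden L s → s ≤ z → label s ≤ℕ label z
    golden-≤ gs s≤z with ≤⇒≡⊎< s≤z
    ... | inj₁ refl = ℕ.≤-refl
    ... | inj₂ s<z = ℕ.<⇒≤ (gs _ s<z)

    GoldenRootChain : Subset n → Set
    GoldenRootChain S = GoldenSet L S × r ∈ S × IsChainOn S

    opaque
      maxLabelBelow : Subset n → Fin n → ℕ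
      maxLabelBelow S x = max 0 (map label (filter (λ s → s ∈? S ×-dec s <? x) (allFin n)))

      maxLabelBelow-≥ : ∀ {S x s} → s ∈ S → s < x → label s ≤ℕ maxLabelBelow S x
      maxLabelBelow-≥ {S} {x} {s} s∈S s<x =
        All.lookup (xs≤max 0 _)
                   (∈-map⁺ label (∈-filter⁺ (λ s → s ∈? S ×-dec s <? x) (∈-allFin s) (s∈S , s<x)))

      maxLabelBelow-attained : ∀ S x → maxLabelBelow S x ≡ 0 ⊎
                               ∃ λ s → s ∈ S × s < x × maxLabelBelow S x ≡ label s
      maxLabelBelow-attained S x with argmax-sel id 0 (map label (filter (λ s → s ∈? S ×-dec s <? x) (allFin n)))
      ... | inj₁ ≡0 = inj₁ ≡0
      ... | inj₂ ∈labels with ∈-map⁻ label ∈labels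
      ...   | s , s∈ , ≡label with ∈-filter⁻ (λ s → s ∈? S ×-dec s <? x) {xs = allFin n} s∈
      ...     | _ , s∈S , s<x = inj₂ (s , s∈S , s<x , ≡label)

    opaque
      relabel : Subset n → Fin n → ℕ
      relabel S x = if does (x ∈? S) then suc (maxLabelBelow S x) else suc (label x)

      labelingOf : Subset n → Vec ℕ n
      labelingOf S = tabulate (relabel S)

      labelingOf-∈ : ∀ {S x} → x ∈ S → lookup (labelingOf S) x ≡ suc (maxLabelBelow S x)
      labelingOf-∈ {S} {x} x∈S =
        trans (Vec.lookup∘tabulate (relabel S) x)
              (cong (λ c → if c then suc (maxLabelBelow S x) else suc (label x)) (dec-true (x ∈? S) x∈S))

      labelingOf-∉ : ∀ {S x} → x ∉ S → lookup (labelingOf S) x ≡ suc (label x)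
      labelingOf-∉ {S} {x} x∉S =
        trans (Vec.lookup∘tabulate (relabel S) x)
              (cong (λ c → if c then suc (maxLabelBelow S x) else suc (label x)) (dec-false (x ∈? S) x∉S))

    module FromChain {S : Subset n} (goldenS : GoldenSet L S) (r∈S : r ∈ S) (chainS : IsChainOn S) where
      L′ : Vec ℕ n
      L′ = labelingOf S
      open Promotion P L′

      maxLabelBelow<label : ∀ x → maxLabelBelow S x <ℕ label x
      maxLabelBelow<label x with maxLabelBelow-attained S x
      ... | inj₁ ≡0 rewrite ≡0 = label-positive x
      ... | inj₂ (s , s∈S , s<x , ≡label) rewrite ≡label = goldenS s s∈S x s<x

      ℓ-above : ∀ {x z} → x ∈ S → x < z → suc (label x) ≤ℕ ℓ z
      ℓ-above {x} {z} x∈S x<z with z ∈? S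
      ... | yes z∈S rewrite labelingOf-∈ z∈S = s≤s (maxLabelBelow-≥ x∈S x<z)
      ... | no z∉S rewrite labelingOf-∉ z∉S = s≤s (ℕ.<⇒≤ (goldenS x x∈S z x<z))

      -- The successor of x in S is the element of S above x with least label.
      successorInS : ∀ {x} → x ∈ S → x ≢ r → ∃ λ z → z ∈ S × x < z × maxLabelBelow S z ≡ label x
      successorInS {x} x∈S x≢r with ∃-minimiser label (λ y → y ∈? S ×-dec x <? y) (r , r∈S , ≢r⇒<r x≢r)
      ... | z , (z∈S , x<z) , least = z , z∈S , x<z , ℕ.≤-antisym maxBelow≤ (maxLabelBelow-≥ x∈S x<z)
        where
        maxBelow≤ : maxLabelBelow S z ≤ℕ label x
        maxBelow≤ with maxLabelBelow-attained S z
        ... | inj₁ ≡0 rewrite ≡0 = z≤n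
        ... | inj₂ (s , s∈S , s<z , ≡label) rewrite ≡label with chainS s x s∈S x∈S
        ...   | inj₁ s≤x = golden-≤ (goldenS s s∈S) s≤x
        ...   | inj₂ x≤s with ≤⇒≡⊎< x≤s
        ...     | inj₁ refl = ℕ.≤-refl
        ...     | inj₂ x<s = ⊥-elim (ℕ.<⇒≱ (goldenS s s∈S z s<z) (least s (s∈S , x<s)))

      succL-r : succL L′ r ≡ nothing
      succL-r with succL L′ r in eq
      ... | nothing = refl
      ... | just _ = ⊥-elim (r-maximal (proj₁ (succL-least eq)))

      succL-∈ : ∀ {x} → x ∈ S → x ≢ r →
                ∃ λ y → succL L′ x ≡ just y × y ∈ S × x < y × ℓ y ≡ suc (label x)
      succL-∈ {x} x∈S x≢r with succL L′ x in eq
      ... | nothing = ⊥-elim (succL-maximal eq (≢r⇒<r x≢r))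
      ... | just y with succL-least eq | successorInS x∈S x≢r
      ...   | x<y , least | z , z∈S , x<z , ≡label = y , refl , y∈S , x<y , ℓy≡
        where
        ℓy≡ : ℓ y ≡ suc (label x)
        ℓy≡ = ℕ.≤-antisym
                (ℕ.≤-trans (least x<z) (ℕ.≤-reflexive (trans (labelingOf-∈ z∈S) (cong suc ≡label))))
                          (ℓ-above x∈S x<y)
        y∈S : y ∈ S
        y∈S with y ∈? S
        ... | yes y∈S = y∈S
        ... | no y∉S = ⊥-elim (ℕ.<-irrefl (sym ℓy≡)
                                 (ℕ.≤-trans (s≤s (goldenS x x∈S y x<y))
                                            (ℕ.≤-reflexive (sym (labelingOf-∉ y∉S)))))

      ∃ℓ≡1 : ∃ λ m → ℓ m ≡ 1
      ∃ℓ≡1 with ∃-minimiser label (_∈? S) (r , r∈S)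
      ... | m , m∈S , least with maxLabelBelow-attained S m
      ...   | inj₁ ≡0 = m , trans (labelingOf-∈ m∈S) (cong suc ≡0)
      ...   | inj₂ (s , s∈S , s<m , _) = ⊥-elim (ℕ.<⇒≱ (goldenS s s∈S m s<m) (least s s∈S))

      v₁ : Fin n
      v₁ = proj₁ (inv1-spec (proj₂ ∃ℓ≡1))

      ℓv₁≡1 : ℓ v₁ ≡ 1
      ℓv₁≡1 = proj₂ (proj₂ (inv1-spec (proj₂ ∃ℓ≡1)))

      promotionChain≡ : promotionChain L′ ≡ chainFrom L′ n v₁
      promotionChain≡ = cong (maybe (chainFrom L′ n) []) (proj₁ (proj₂ (inv1-spec (proj₂ ∃ℓ≡1))))

      v₁∈S : v₁ ∈ S
      v₁∈S with v₁ ∈? S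
      ... | yes v₁∈S = v₁∈S
      ... | no v₁∉S =
        ⊥-elim (ℕ.<-irrefl (ℕ.suc-injective (trans (sym ℓv₁≡1) (labelingOf-∉ v₁∉S))) (label-positive v₁))

      v₁-least : ∀ {s} → s ∈ S → v₁ ≤ s
      v₁-least {s} s∈S with chainS v₁ s v₁∈S s∈S
      ... | inj₁ v₁≤s = v₁≤s
      ... | inj₂ s≤v₁ with ≤⇒≡⊎< s≤v₁
      ...   | inj₁ refl = ≤-refl
      ...   | inj₂ s<v₁ =
        ⊥-elim (ℕ.<-irrefl (sym maxBelow≡0) (ℕ.<-≤-trans (label-positive s) (maxLabelBelow-≥ s∈S s<v₁)))
        where
        maxBelow≡0 : maxLabelBelow S v₁ ≡ 0
        maxBelow≡0 = ℕ.suc-injective (trans (sym (labelingOf-∈ v₁∈S)) ℓv₁≡1)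

      -- Labels strictly increase along the chain, so n ∸ label v bounds the fuel it needs.
      fuel-step : ∀ {f v y} → v ∈ S → v < y → n ∸ label v <ℕ suc f → n ∸ label y <ℕ f
      fuel-step {v = v} {y} v∈S v<y fuel =
        ℕ.<-≤-trans (ℕ.∸-monoʳ-< (goldenS v v∈S y v<y) (label-≤n y)) (ℕ.≤-pred fuel)

      chainFrom-⊆ : ∀ f {v} → v ∈ S → n ∸ label v <ℕ f → ∀ {x} → x ∈ᴸ chainFrom L′ f v → x ∈ S
      chainFrom-⊆ (suc f) v∈S fuel (here refl) = v∈S
      chainFrom-⊆ (suc f) {v} v∈S fuel (there x∈) with v ≟F r
      ... | yes refl rewrite succL-r = case x∈ of λ ()
      ... | no v≢r with succL-∈ v∈S v≢r
      ...   | y , eq , y∈S , v<y , _ rewrite eq =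
        chainFrom-⊆ f y∈S (fuel-step v∈S v<y fuel) x∈

      chainFrom-⊇ : ∀ f {v} → v ∈ S → n ∸ label v <ℕ f →
                    ∀ {x} → x ∈ S → v ≤ x → x ∈ᴸ chainFrom L′ f v
      chainFrom-⊇ (suc f) {v} v∈S fuel {x} x∈S v≤x with ≤⇒≡⊎< v≤x
      ... | inj₁ refl = here refl
      ... | inj₂ v<x with v ≟F r
      ...   | yes refl = ⊥-elim (r-maximal v<x)
      ...   | no v≢r with succL-∈ v∈S v≢r
      ...     | y , eq , y∈S , v<y , ℓy≡ rewrite eq =
        there (chainFrom-⊇ f y∈S (fuel-step v∈S v<y fuel) x∈S y≤x)
        where
        y≤x : y ≤ x
        y≤x with chainS x y x∈S y∈S
        ... | inj₂ y≤x = y≤x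
        ... | inj₁ x≤y with ≤⇒≡⊎< x≤y
        ...   | inj₁ refl = ≤-refl
        ...   | inj₂ x<y =
          ⊥-elim (ℕ.<⇒≱ (s≤s (goldenS v v∈S x v<x)) (ℕ.≤-trans (ℓ-above x∈S x<y) (ℕ.≤-reflexive ℓy≡)))

      promotionChain-labelingOf : ∀ x → x ∈ᴸ promotionChain L′ ⇔ x ∈ S
      promotionChain-labelingOf x =
        mk⇔ (λ x∈ → chainFrom-⊆ n v₁∈S fuel (subst (x ∈ᴸ_) promotionChain≡ x∈))
            (λ x∈S → subst (x ∈ᴸ_) (sym promotionChain≡) (chainFrom-⊇ n v₁∈S fuel x∈S (v₁-least x∈S)))
        where
        fuel : n ∸ label v₁ <ℕ n
        fuel = ℕ.∸-monoʳ-< {o = 0} (label-positive v₁) (label-≤n v₁)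

      ∂-labelingOf : ∂ L′ ≡ L
      ∂-labelingOf = trans (Vec.tabulate-cong ∂-at) (Vec.tabulate∘lookup L)
        where
        ∂-at : ∀ x → (if ⌊ any? (x ≟F_) (promotionChain L′) ⌋
                        then maybe (λ w → ℓ w ∸ 1) n (succL L′ x) else ℓ x ∸ 1) ≡ label x
        ∂-at x with any? (x ≟F_) (promotionChain L′)
        ... | no x∉ = cong (_∸ 1) (labelingOf-∉ (x∉ ∘ from (promotionChain-labelingOf x)))
        ... | yes x∈ with x ≟F r
        ...   | yes refl rewrite succL-r = sym label-r
        ...   | no x≢r with succL-∈ (to (promotionChain-labelingOf x) x∈) x≢r
        ...     | y , eq , _ , _ , ℓy≡ rewrite eq | ℓy≡ = refl

      ℓ-range : ∀ x → 1 ≤ℕ ℓ x × ℓ x ≤ℕ n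
      ℓ-range x with x ∈? S
      ... | yes x∈S rewrite labelingOf-∈ x∈S = s≤s z≤n , ℕ.<-≤-trans (maxLabelBelow<label x) (label-≤n x)
      ... | no x∉S rewrite labelingOf-∉ x∉S = s≤s z≤n , ℕ.≤∧≢⇒< (label-≤n x) label≢n
        where
        label≢n : label x ≢ n
        label≢n ≡n = x∉S (subst (_∈ S) (label-injective (trans label-r (sym ≡n))) r∈S)

      private
        ℓ-injective-∈∉ : ∀ {x y} → x ∈ S → y ∉ S → ℓ x ≢ ℓ y
        ℓ-injective-∈∉ {x} {y} x∈S y∉S ℓx≡ℓy with maxLabelBelow-attained S x
        ... | inj₁ ≡0 = ℕ.<-irrefl (trans (sym ≡0) maxBelow≡) (label-positive y)
          where maxBelow≡ = ℕ.suc-injective (trans (sym (labelingOf-∈ x∈S)) (trans ℓx≡ℓy (labelingOf-∉ y∉S)))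
        ... | inj₂ (s , s∈S , _ , ≡label) =
          y∉S (subst (_∈ S) (label-injective (trans (sym ≡label) maxBelow≡)) s∈S)
          where maxBelow≡ = ℕ.suc-injective (trans (sym (labelingOf-∈ x∈S)) (trans ℓx≡ℓy (labelingOf-∉ y∉S)))

        ℓ-injective-< : ∀ {x y} → x ∈ S → x < y → ℓ x ≢ ℓ y
        ℓ-injective-< x∈S x<y ℓx≡ℓy =
          ℕ.<⇒≱ (s≤s (maxLabelBelow<label _))
                (ℕ.≤-trans (ℓ-above x∈S x<y) (ℕ.≤-reflexive (trans (sym ℓx≡ℓy) (labelingOf-∈ x∈S))))

        ℓ-injective-∈∈ : ∀ {x y} → x ∈ S → y ∈ S → ℓ x ≡ ℓ y → x ≡ y
        ℓ-injective-∈∈ x∈S y∈S ℓx≡ℓy with chainS _ _ x∈S y∈S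
        ... | inj₁ x≤y = ≤∧≮⇒≡ x≤y (λ x<y → ℓ-injective-< x∈S x<y ℓx≡ℓy)
        ... | inj₂ y≤x = sym (≤∧≮⇒≡ y≤x (λ y<x → ℓ-injective-< y∈S y<x (sym ℓx≡ℓy)))

      ℓ-injective : ∀ x y → ℓ x ≡ ℓ y → x ≡ y
      ℓ-injective x y ℓx≡ℓy with x ∈? S | y ∈? S
      ... | yes x∈S | yes y∈S = ℓ-injective-∈∈ x∈S y∈S ℓx≡ℓy
      ... | yes x∈S | no y∉S = ⊥-elim (ℓ-injective-∈∉ x∈S y∉S ℓx≡ℓy)
      ... | no x∉S | yes y∈S = ⊥-elim (ℓ-injective-∈∉ y∈S x∉S (sym ℓx≡ℓy))
      ... | no x∉S | no y∉S =
        label-injective (ℕ.suc-injective (trans (sym (labelingOf-∉ x∉S)) (trans ℓx≡ℓy (labelingOf-∉ y∉S))))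

      -- The label i + 1 is taken off S by L⁻¹(i), and on S by the successor in S of L⁻¹(i).
      ℓ-surjective : ∀ i → 1 ≤ℕ i → i ≤ℕ n → ∃ λ x → ℓ x ≡ i
      ℓ-surjective (suc zero) _ _ = ∃ℓ≡1
      ℓ-surjective (suc (suc i)) _ i+2≤n with label-surjective (s≤s z≤n) (ℕ.≤-trans (ℕ.n≤1+n _) i+2≤n)
      ... | w , label-w with w ∈? S
      ...   | no w∉S = w , trans (labelingOf-∉ w∉S) (cong suc label-w)
      ...   | yes w∈S with successorInS w∈S (λ { refl → ℕ.<-irrefl (trans (sym label-w) label-r) i+2≤n })
      ...     | z , z∈S , _ , ≡label = z , trans (labelingOf-∈ z∈S) (cong suc (trans ≡label label-w))

      labelingOf-isLabeling : IsLabeling L′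
      labelingOf-isLabeling = ℓ-range , ℓ-injective , ℓ-surjective

    module ToChain {L′ : Vec ℕ n} (isLabeling′ : IsLabeling L′) (∂L′≡L : ∂ L′ ≡ L) where
      open Promotion P L′

      ℓ-positive : ∀ x → 1 ≤ℕ ℓ x
      ℓ-positive x = proj₁ (proj₁ isLabeling′ x)

      private
        ∃ℓ≡1 : ∃ λ a → ℓ a ≡ 1
        ∃ℓ≡1 = proj₂ (proj₂ isLabeling′) 1 (s≤s z≤n) 1≤n

      v₁ : Fin n
      v₁ = proj₁ (inv1-spec (proj₂ ∃ℓ≡1))

      chain : List (Fin n)
      chain = chainFrom L′ n v₁

      promotionChain≡ : promotionChain L′ ≡ chain
      promotionChain≡ = cong (maybe (chainFrom L′ n) []) (proj₁ (proj₂ (inv1-spec (proj₂ ∃ℓ≡1))))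

      v₁∈chain : v₁ ∈ᴸ chain
      v₁∈chain = head∈chainFrom 1≤n
        where
        head∈chainFrom : ∀ {f v} → 1 ≤ℕ f → v ∈ᴸ chainFrom L′ f v
        head∈chainFrom (s≤s _) = here refl

      label-∂ : ∀ x → label x ≡ (if ⌊ any? (x ≟F_) (promotionChain L′) ⌋
                                  then maybe (λ w → ℓ w ∸ 1) n (succL L′ x) else ℓ x ∸ 1)
      label-∂ x = trans (cong (λ v → lookup v x) (sym ∂L′≡L)) (Vec.lookup∘tabulate _ x)

      label-onChain : ∀ {x} → x ∈ᴸ chain → label x ≡ maybe (λ w → ℓ w ∸ 1) n (succL L′ x)
      label-onChain {x} x∈ with any? (x ≟F_) (promotionChain L′) | label-∂ x
      ... | yes _ | eq = eq
      ... | no x∉ | _ = ⊥-elim (x∉ (subst (x ∈ᴸ_) (sym promotionChain≡) x∈))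

      label-offChain : ∀ {x} → ¬ x ∈ᴸ chain → label x ≡ ℓ x ∸ 1
      label-offChain {x} x∉ with any? (x ≟F_) (promotionChain L′) | label-∂ x
      ... | yes x∈ | _ = ⊥-elim (x∉ (subst (x ∈ᴸ_) promotionChain≡ x∈))
      ... | no _ | eq = eq

      label-last : ∀ {x} → x ∈ᴸ chain → succL L′ x ≡ nothing → label x ≡ n
      label-last x∈ eq = trans (label-onChain x∈) (cong (maybe (λ w → ℓ w ∸ 1) n) eq)

      label-step : ∀ {x y} → x ∈ᴸ chain → succL L′ x ≡ just y → label x ≡ ℓ y ∸ 1
      label-step x∈ eq = trans (label-onChain x∈) (cong (maybe (λ w → ℓ w ∸ 1) n) eq)

      private
        top : ∃ λ w → w ∈ᴸ chain × ∀ {y} → y ∈ᴸ chain → ¬ w < y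
        top = ∃-maximal (λ x → any? (x ≟F_) chain) (v₁ , v₁∈chain)

      w : Fin n
      w = proj₁ top

      w∈chain : w ∈ᴸ chain
      w∈chain = proj₁ (proj₂ top)

      ≤w : ∀ {y} → y ∈ᴸ chain → y ≤ w
      ≤w y∈ with chainFrom-total n v₁ y∈ w∈chain
      ... | inj₁ y≤w = y≤w
      ... | inj₂ w≤y = ≤-reflexive (sym (≤∧≮⇒≡ w≤y (proj₂ (proj₂ top) y∈)))

      -- The top w of the promotion chain receives label n from ∂, so w = r.
      r∈chain : r ∈ᴸ chain
      r∈chain with succL L′ w in eq
      ... | nothing = subst (_∈ᴸ chain) (label-injective (trans (label-last w∈chain eq) (sym label-r))) w∈chain
      ... | just y = ⊥-elim (<-irrefl (subst (w <_) (sym w≡y) w<y))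
        where
        w<y = proj₁ (succL-least eq)
        y∉ : ¬ y ∈ᴸ chain
        y∉ y∈ = <-asym w<y (≤w y∈)
        w≡y : w ≡ y
        w≡y = label-injective (trans (label-step w∈chain eq) (sym (label-offChain y∉)))

      label-≤-above : ∀ {x z} → x ∈ᴸ chain → x < z → label x ≤ℕ label z
      label-≤-above {x} {z} x∈ x<z with succL L′ x in eq
      ... | nothing = ⊥-elim (succL-maximal eq x<z)
      ... | just y with succL-least eq
      ...   | x<y , least rewrite label-step x∈ eq with any? (z ≟F_) chain
      ...     | no z∉ rewrite label-offChain z∉ = ℕ.∸-monoˡ-≤ 1 (least x<z)
      ...     | yes z∈ with succL L′ z in eq′
      ...       | nothing rewrite label-last z∈ eq′ = ℕ.≤-trans (ℕ.m∸n≤m _ 1) (proj₂ (proj₁ isLabeling′ y))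
      ...       | just y′ rewrite label-step z∈ eq′ =
        ℕ.∸-monoˡ-≤ 1 (least (<-trans x<z (proj₁ (succL-least eq′))))

      chain-golden : ∀ {x} → x ∈ᴸ chain → Golden L x
      chain-golden x∈ z x<z = ℕ.≤∧≢⇒< (label-≤-above x∈ x<z) (proj₂ x<z ∘ label-injective)

      chainSet : Subset n
      chainSet = subsetOf (λ x → any? (x ≟F_) chain)

      ∈chainSet⁺ : ∀ {x} → x ∈ᴸ chain → x ∈ chainSet
      ∈chainSet⁺ = ∈-subsetOf⁺ (λ x → any? (x ≟F_) chain)

      ∈chainSet⁻ : ∀ {x} → x ∈ chainSet → x ∈ᴸ chain
      ∈chainSet⁻ = ∈-subsetOf⁻ (λ x → any? (x ≟F_) chain)

      chainSet-goldenRootChain : GoldenRootChain chainSet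
      chainSet-goldenRootChain =
        (λ x x∈ → chain-golden (∈chainSet⁻ x∈)) ,
        ∈chainSet⁺ r∈chain ,
        (λ x y x∈ y∈ → chainFrom-total n v₁ (∈chainSet⁻ x∈) (∈chainSet⁻ y∈))

      private
        ℓv₁≡1 : ℓ v₁ ≡ 1
        ℓv₁≡1 = proj₂ (proj₂ (inv1-spec (proj₂ ∃ℓ≡1)))

        maxLabelBelow-v₁ : maxLabelBelow chainSet v₁ ≡ 0
        maxLabelBelow-v₁ with maxLabelBelow-attained chainSet v₁
        ... | inj₁ ≡0 = ≡0
        ... | inj₂ (s , s∈ , s<v₁ , _) = ⊥-elim (<-asym s<v₁ (chainFrom-≥ n v₁ (∈chainSet⁻ s∈)))

        maxLabelBelow-successor : ∀ {p x} → p ∈ᴸ chain → succL L′ p ≡ just x →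
                                  maxLabelBelow chainSet x ≡ label p
        maxLabelBelow-successor {p} {x} p∈ eq with proj₁ (succL-least eq)
        ... | p<x with maxLabelBelow-attained chainSet x
        ...   | inj₁ ≡0 =
          ⊥-elim (ℕ.<-irrefl (sym ≡0) (ℕ.<-≤-trans (label-positive p) (maxLabelBelow-≥ (∈chainSet⁺ p∈) p<x)))
        ...   | inj₂ (s , s∈ , s<x , ≡label) =
          ℕ.≤-antisym (ℕ.≤-trans (ℕ.≤-reflexive ≡label) label-s≤) (maxLabelBelow-≥ (∈chainSet⁺ p∈) p<x)
          where
          label-s≤ : label s ≤ℕ label p
          label-s≤ with chainFrom-total n v₁ (∈chainSet⁻ s∈) p∈
          ... | inj₁ s≤p = golden-≤ (chain-golden (∈chainSet⁻ s∈)) s≤p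
          ... | inj₂ p≤s with ≤⇒≡⊎< p≤s
          ...   | inj₁ refl = ℕ.≤-refl
          ...   | inj₂ p<s = ⊥-elim (chainFrom-noGap n v₁ p∈ (∈chainSet⁻ s∈) eq p<s s<x)

      labelingOf-chainSet : labelingOf chainSet ≡ L′
      labelingOf-chainSet =
        trans (sym (Vec.tabulate∘lookup _)) (trans (Vec.tabulate-cong at) (Vec.tabulate∘lookup L′))
        where
        at : ∀ x → lookup (labelingOf chainSet) x ≡ ℓ x
        at x with any? (x ≟F_) chain
        ... | no x∉ = trans (labelingOf-∉ (x∉ ∘ ∈chainSet⁻))
                            (trans (cong suc (label-offChain x∉)) (ℕ.m+[n∸m]≡n (ℓ-positive x)))
        ... | yes x∈ with chainFrom-predecessor n v₁ x∈
        ...   | inj₁ refl =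
          trans (labelingOf-∈ (∈chainSet⁺ x∈)) (trans (cong suc maxLabelBelow-v₁) (sym ℓv₁≡1))
        ...   | inj₂ (p , p∈ , eq) =
          trans (labelingOf-∈ (∈chainSet⁺ x∈))
                (trans (cong suc (trans (maxLabelBelow-successor p∈ eq) (label-step p∈ eq)))
                       (ℕ.m+[n∸m]≡n (ℓ-positive x)))

    labelingOf-injective : ∀ {S S′} → GoldenRootChain S → GoldenRootChain S′ →
                           labelingOf S ≡ labelingOf S′ → S ≡ S′
    labelingOf-injective (gS , rS , cS) (gS′ , rS′ , cS′) eq =
      ⊆-antisym (λ {x} → to (chain′ x) ∘ subst (λ L′ → x ∈ᴸ promotionChain L′) eq ∘ from (chain x))
                (λ {x} → to (chain x) ∘ subst (λ L′ → x ∈ᴸ promotionChain L′) (sym eq) ∘ from (chain′ x))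
      where
      chain = FromChain.promotionChain-labelingOf gS rS cS
      chain′ = FromChain.promotionChain-labelingOf gS′ rS′ cS′

    HasCard-∂⁻¹ : ∀ {m} → HasCard GoldenRootChain m → HasCard (λ L′ → IsLabeling L′ × ∂ L′ ≡ L) m
    HasCard-∂⁻¹ = HasCard-cong preimage ∘ HasCard-image labelingOf labelingOf-injective
      where
      preimage : ∀ L′ → (∃ λ S → GoldenRootChain S × labelingOf S ≡ L′) ⇔ (IsLabeling L′ × ∂ L′ ≡ L)
      preimage L′ = mk⇔
        (λ { (S , (gS , rS , cS) , refl) → FromChain.labelingOf-isLabeling gS rS cS , FromChain.∂-labelingOf gS rS cS })
        (λ (isLabeling′ , ∂L′≡L) → let open ToChain isLabeling′ ∂L′≡L in
                                   chainSet , chainSet-goldenRootChain , labelingOf-chainSet)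

    goldenBelow : Fin n → Subset n
    goldenBelow ρ = subsetOf (λ y → golden? y ×-dec y ≤? ρ)

    ∈goldenBelow⁺ : ∀ {ρ y} → Golden L y × y ≤ ρ → y ∈ goldenBelow ρ
    ∈goldenBelow⁺ {ρ} = ∈-subsetOf⁺ (λ y → golden? y ×-dec y ≤? ρ)

    ∈goldenBelow⁻ : ∀ {ρ y} → y ∈ goldenBelow ρ → Golden L y × y ≤ ρ
    ∈goldenBelow⁻ {ρ} = ∈-subsetOf⁻ (λ y → golden? y ×-dec y ≤? ρ)

    goldenBelow-subtree : ∀ {ρ} → Golden L ρ → ρ < b → GoldenSubtreeBelow L b (goldenBelow ρ)
    goldenBelow-subtree {ρ} golden-ρ ρ<b =
      (((ρ , ρ∈) , λ x y x∈ y∈ → (x∈ , ρ∈ , inj₁ (≤ρ x∈)) ◅ (ρ∈ , y∈ , inj₂ (≤ρ y∈)) ◅ ε) ,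
       coverUnique) ,
      (λ x x∈ → proj₁ (∈goldenBelow⁻ x∈)) ,
      ρ , (ρ∈ , λ x x∈ → ≤ρ x∈) , ρ<b
      where
      ρ∈ : ρ ∈ goldenBelow ρ
      ρ∈ = ∈goldenBelow⁺ (golden-ρ , ≤-refl)
      ≤ρ : ∀ {x} → x ∈ goldenBelow ρ → x ≤ ρ
      ≤ρ x∈ = proj₂ (∈goldenBelow⁻ x∈)
      coverUnique : ∀ x y z → CoversIn (goldenBelow ρ) x y → CoversIn (goldenBelow ρ) x z → y ≡ z
      coverUnique x y z (_ , y∈ , x<y , ⋖y) (_ , z∈ , x<z , ⋖z) with upperSet-total (proj₁ x<y) (proj₁ x<z)
      ... | inj₁ y≤z = ≤∧≮⇒≡ y≤z (⋖z y y∈ x<y)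
      ... | inj₂ z≤y = sym (≤∧≮⇒≡ z≤y (⋖y z z∈ x<z))

    NoGoldenBetween : Fin n → Set
    NoGoldenBetween ρ = ∀ {σ} → Golden L σ → ρ < σ → ¬ σ < b

    module Count (C : Subset n) (maxChainC : IsMaxGoldenChainAbove L b C)
                 (𝓜 : List (Subset n)) (𝓜-unique : Unique 𝓜)
                 (∈𝓜⇔ : ∀ T → (T ∈ᴸ 𝓜) ⇔ InM L b T) where

      ∈C⇒ : ∀ {y} → y ∈ C → b ≤ y × Golden L y
      ∈C⇒ {y} y∈C = proj₁ maxChainC y y∈C , proj₁ (proj₂ (proj₂ maxChainC)) y y∈C

      ⇒∈C : ∀ {y} → b ≤ y → Golden L y → y ∈ C
      ⇒∈C {y} b≤y golden-y =
        proj₂ (proj₂ (proj₂ maxChainC)) (C ∪ ⁅ y ⁆) (p⊆p∪q ⁅ y ⁆) above chain golden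
          (x∈p∪q⁺ (inj₂ (x∈⁅x⁆ y)))
        where
        above : ∀ z → z ∈ C ∪ ⁅ y ⁆ → b ≤ z
        above z z∈ = [ proj₁ ∘ ∈C⇒ , (λ z∈⁅y⁆ → subst (b ≤_) (sym (x∈⁅y⁆⇒x≡y y z∈⁅y⁆)) b≤y) ]
                     (x∈p∪q⁻ C ⁅ y ⁆ z∈)
        golden : GoldenSet L (C ∪ ⁅ y ⁆)
        golden z z∈ = [ proj₂ ∘ ∈C⇒ , (λ z∈⁅y⁆ → subst (Golden L) (sym (x∈⁅y⁆⇒x≡y y z∈⁅y⁆)) golden-y) ]
                      (x∈p∪q⁻ C ⁅ y ⁆ z∈)
        chain : IsChainOn (C ∪ ⁅ y ⁆)
        chain z z′ z∈ z′∈ = upperSet-total (above z z∈) (above z′ z′∈)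

      r∈C : r ∈ C
      r∈C = ⇒∈C b≤r r-golden

      𝓜-shape : ∀ {T} → T ∈ᴸ 𝓜 →
                ∃ λ ρ → T ≡ goldenBelow ρ × Golden L ρ × ρ < b × NoGoldenBetween ρ
      𝓜-shape {T} T∈𝓜 with to (∈𝓜⇔ T) T∈𝓜
      ... | (_ , goldenT , ρ , (ρ∈T , ≤ρ) , ρ<b) , maximalT = ρ , T≡ , golden-ρ , ρ<b , noBetween
        where
        golden-ρ = goldenT ρ ρ∈T
        T⊆ : ∀ {σ} → ρ ≤ σ → T ⊆ goldenBelow σ
        T⊆ ρ≤σ {y} y∈T = ∈goldenBelow⁺ (goldenT y y∈T , ≤-trans (≤ρ y y∈T) ρ≤σ)
        T≡ : T ≡ goldenBelow ρ
        T≡ = ⊆-antisym (T⊆ ≤-refl) (maximalT (goldenBelow ρ) (T⊆ ≤-refl) (goldenBelow-subtree golden-ρ ρ<b))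
        noBetween : NoGoldenBetween ρ
        noBetween {σ} golden-σ ρ<σ σ<b =
          <-asym ρ<σ (≤ρ σ (maximalT (goldenBelow σ) (T⊆ (proj₁ ρ<σ)) (goldenBelow-subtree golden-σ σ<b)
                            (∈goldenBelow⁺ (golden-σ , ≤-refl))))

      ∈𝓜-golden-<b : ∀ {T x} → T ∈ᴸ 𝓜 → x ∈ T → Golden L x × x < b
      ∈𝓜-golden-<b T∈𝓜 x∈T with 𝓜-shape T∈𝓜
      ... | ρ , refl , _ , ρ<b , _ with ∈goldenBelow⁻ x∈T
      ...   | golden-x , x≤ρ = golden-x , ≤-<-trans x≤ρ ρ<b

      -- The tree of 𝓜 containing x is the one below the highest golden ρ ≥ x under b.
      golden-<b⇒∈𝓜 : ∀ {x} → Golden L x → x < b → ∃ λ T → T ∈ᴸ 𝓜 × x ∈ T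
      golden-<b⇒∈𝓜 {x} golden-x x<b
        with ∃-maximal (λ ρ → golden? ρ ×-dec x ≤? ρ ×-dec ρ <? b) (x , golden-x , ≤-refl , x<b)
      ... | ρ , (golden-ρ , x≤ρ , ρ<b) , highest-ρ =
        goldenBelow ρ , from (∈𝓜⇔ (goldenBelow ρ)) (goldenBelow-subtree golden-ρ ρ<b , maximal) ,
        ∈goldenBelow⁺ (golden-x , x≤ρ)
        where
        maximal : ∀ S → goldenBelow ρ ⊆ S → GoldenSubtreeBelow L b S → S ⊆ goldenBelow ρ
        maximal S ⊆S (_ , goldenS , σ , (σ∈S , ≤σ) , σ<b) {y} y∈S
          with ≤⇒≡⊎< (≤σ ρ (⊆S (∈goldenBelow⁺ (golden-ρ , ≤-refl))))
        ... | inj₁ refl = ∈goldenBelow⁺ (goldenS y y∈S , ≤σ y y∈S)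
        ... | inj₂ ρ<σ = ⊥-elim (highest-ρ (goldenS σ σ∈S , ≤-trans x≤ρ (proj₁ ρ<σ) , σ<b) ρ<σ)

      𝓜-disjoint : ∀ {T T′ x} → T ∈ᴸ 𝓜 → T′ ∈ᴸ 𝓜 → x ∈ T → x ∈ T′ → T ≡ T′
      𝓜-disjoint T∈𝓜 T′∈𝓜 x∈T x∈T′ with 𝓜-shape T∈𝓜 | 𝓜-shape T′∈𝓜
      ... | ρ , refl , golden-ρ , ρ<b , noBetween | ρ′ , refl , golden-ρ′ , ρ′<b , noBetween′
        with upperSet-total (proj₂ (∈goldenBelow⁻ x∈T))
                            (proj₂ (∈goldenBelow⁻ x∈T′))
      ...   | inj₁ ρ≤ρ′ = cong goldenBelow (≤∧≮⇒≡ ρ≤ρ′ λ ρ<ρ′ → noBetween golden-ρ′ ρ<ρ′ ρ′<b)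
      ...   | inj₂ ρ′≤ρ = cong goldenBelow (sym (≤∧≮⇒≡ ρ′≤ρ λ ρ′<ρ → noBetween′ golden-ρ ρ′<ρ ρ<b))

      C∖r : Subset n
      C∖r = subsetOf (λ y → y ∈? C ×-dec ¬? (y ≟F r))

      ∈C∖r⁺ : ∀ {y} → y ∈ C × y ≢ r → y ∈ C∖r
      ∈C∖r⁺ = ∈-subsetOf⁺ (λ y → y ∈? C ×-dec ¬? (y ≟F r))

      ∈C∖r⁻ : ∀ {y} → y ∈ C∖r → y ∈ C × y ≢ r
      ∈C∖r⁻ = ∈-subsetOf⁻ (λ y → y ∈? C ×-dec ¬? (y ≟F r))

      between : Fin n → Subset n
      between x = subsetOf (λ y → golden? y ×-dec x <? y ×-dec y <? r)

      ∈between⁺ : ∀ {x y} → Golden L y × x < y × y < r → y ∈ between x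
      ∈between⁺ {x} = ∈-subsetOf⁺ (λ y → golden? y ×-dec x <? y ×-dec y <? r)

      ∈between⁻ : ∀ {x y} → y ∈ between x → Golden L y × x < y × y < r
      ∈between⁻ {x} = ∈-subsetOf⁻ (λ y → golden? y ×-dec x <? y ×-dec y <? r)

      AboveB : Subset n → Set
      AboveB S = ⁅ r ⁆ ⊆ S × S ⊆ ⁅ r ⁆ ∪ C∖r

      StartingAt : Fin n → Subset n → Set
      StartingAt x S = ⁅ x ⁆ ∪ ⁅ r ⁆ ⊆ S × S ⊆ (⁅ x ⁆ ∪ ⁅ r ⁆) ∪ between x

      elements : Subset n → List (Fin n)
      elements T = filter (_∈? T) (allFin n)

      ∈elements⁺ : ∀ {T x} → x ∈ T → x ∈ᴸ elements T
      ∈elements⁺ {T} {x} = ∈-filter⁺ (_∈? T) (∈-allFin x)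

      ∈elements⁻ : ∀ {T x} → x ∈ᴸ elements T → x ∈ T
      ∈elements⁻ {T} = proj₂ ∘ ∈-filter⁻ (_∈? T) {xs = allFin n}

      -- elements T is the list innerSum sums over.
      BelowB : Subset n → Set
      BelowB S = ∃ λ T → T ∈ᴸ 𝓜 × ∃ λ x → x ∈ᴸ elements T × StartingAt x S

      private
        AboveB⇒⊆C : ∀ {S} → AboveB S → S ⊆ C
        AboveB⇒⊆C (_ , S⊆) = ∪-lub (x∈p⇒⁅x⁆⊆p r∈C) (proj₁ ∘ ∈C∖r⁻) ∘ S⊆

        ∈-StartingAt : ∀ {x S z} → StartingAt x S → z ∈ S → z ≡ x ⊎ z ≡ r ⊎ (Golden L z × x < z × z < r)
        ∈-StartingAt {x} (_ , S⊆) z∈S with x∈p∪q⁻ (⁅ x ⁆ ∪ ⁅ r ⁆) (between x) (S⊆ z∈S)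
        ... | inj₂ z∈between = inj₂ (inj₂ (∈between⁻ z∈between))
        ... | inj₁ z∈x,r with x∈p∪q⁻ ⁅ x ⁆ ⁅ r ⁆ z∈x,r
        ...   | inj₁ z∈⁅x⁆ = inj₁ (x∈⁅y⁆⇒x≡y x z∈⁅x⁆)
        ...   | inj₂ z∈⁅r⁆ = inj₂ (inj₁ (x∈⁅y⁆⇒x≡y r z∈⁅r⁆))

        StartingAt-least : ∀ {x S} → StartingAt x S → x ∈ S × ∀ {z} → z ∈ S → x ≤ z
        StartingAt-least {x} st@(F⊆S , _) = F⊆S (x∈p∪q⁺ (inj₁ (x∈⁅x⁆ x))) , λ z∈S →
          [ (λ { refl → ≤-refl }) , [ (λ { refl → ≤r x }) , proj₁ ∘ proj₁ ∘ proj₂ ] ] (∈-StartingAt st z∈S)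

        StartingAt-unique : ∀ {x x′ S} → StartingAt x S → StartingAt x′ S → x ≡ x′
        StartingAt-unique st st′ with StartingAt-least st | StartingAt-least st′
        ... | x∈S , x≤ | x′∈S , x′≤ = antisym (x≤ x′∈S) (x′≤ x∈S)

      AboveB⇒goldenRootChain : ∀ {S} → AboveB S → GoldenRootChain S
      AboveB⇒goldenRootChain ab@(⁅r⁆⊆S , _) =
        (λ _ z∈S → proj₂ (∈C⇒ (AboveB⇒⊆C ab z∈S))) ,
        ⁅r⁆⊆S (x∈⁅x⁆ r) ,
        (λ _ _ y∈S z∈S → upperSet-total (proj₁ (∈C⇒ (AboveB⇒⊆C ab y∈S)))
                                        (proj₁ (∈C⇒ (AboveB⇒⊆C ab z∈S))))

      StartingAt⇒goldenRootChain : ∀ {x S} → Golden L x → StartingAt x S → GoldenRootChain S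
      StartingAt⇒goldenRootChain {x} golden-x st@(F⊆S , _) =
        (λ _ z∈S → [ (λ { refl → golden-x }) , [ (λ { refl → r-golden }) , proj₁ ] ] (∈-StartingAt st z∈S)) ,
        F⊆S (x∈p∪q⁺ (inj₂ (x∈⁅x⁆ r))) ,
        (λ _ _ y∈S z∈S → upperSet-total (proj₂ (StartingAt-least st) y∈S) (proj₂ (StartingAt-least st) z∈S))

      goldenRootChain⇒blocks : ∀ {S} → GoldenRootChain S → AboveB S ⊎ BelowB S
      goldenRootChain⇒blocks {S} (goldenS , r∈S , chainS)
        with Data.Fin.Properties.any? (λ y → y ∈? S ×-dec y <? b)
      ... | no ∄<b = inj₁ (x∈p⇒⁅x⁆⊆p r∈S , S⊆)
        where
        b≤ : ∀ {z} → z ∈ S → b ≤ z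
        b≤ {z} z∈S with comparableToB z
        ... | inj₁ b≤z = b≤z
        ... | inj₂ z≤b = ≤-reflexive (sym (≤∧≮⇒≡ z≤b (λ z<b → ∄<b (z , z∈S , z<b))))
        S⊆ : S ⊆ ⁅ r ⁆ ∪ C∖r
        S⊆ {z} z∈S with z ≟F r
        ... | yes refl = x∈p∪q⁺ (inj₁ (x∈⁅x⁆ r))
        ... | no z≢r = x∈p∪q⁺ (inj₂ (∈C∖r⁺ (⇒∈C (b≤ z∈S) (goldenS z z∈S) , z≢r)))
      ... | yes (y , y∈S , y<b) with ∃-minimal (_∈? S) (y , y∈S)
      ...   | x , x∈S , minimal = inj₂ (T , T∈𝓜 , x , ∈elements⁺ x∈T , F⊆S , S⊆)
        where
        x≤ : ∀ {z} → z ∈ S → x ≤ z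
        x≤ {z} z∈S with chainS x z x∈S z∈S
        ... | inj₁ x≤z = x≤z
        ... | inj₂ z≤x = ≤-reflexive (sym (≤∧≮⇒≡ z≤x (minimal z∈S)))
        T = proj₁ (golden-<b⇒∈𝓜 (goldenS x x∈S) (≤-<-trans (x≤ y∈S) y<b))
        T∈𝓜 = proj₁ (proj₂ (golden-<b⇒∈𝓜 (goldenS x x∈S) (≤-<-trans (x≤ y∈S) y<b)))
        x∈T = proj₂ (proj₂ (golden-<b⇒∈𝓜 (goldenS x x∈S) (≤-<-trans (x≤ y∈S) y<b)))
        F⊆S : ⁅ x ⁆ ∪ ⁅ r ⁆ ⊆ S
        F⊆S = ∪-lub (x∈p⇒⁅x⁆⊆p x∈S) (x∈p⇒⁅x⁆⊆p r∈S)
        S⊆ : S ⊆ (⁅ x ⁆ ∪ ⁅ r ⁆) ∪ between x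
        S⊆ {z} z∈S with z ≟F x | z ≟F r
        ... | yes refl | _ = x∈p∪q⁺ (inj₁ (x∈p∪q⁺ (inj₁ (x∈⁅x⁆ x))))
        ... | no _ | yes refl = x∈p∪q⁺ (inj₁ (x∈p∪q⁺ (inj₂ (x∈⁅x⁆ r))))
        ... | no z≢x | no z≢r = x∈p∪q⁺ (inj₂ (∈between⁺
                                                (goldenS z z∈S , (x≤ z∈S , z≢x ∘ sym) , ≢r⇒<r z≢r)))

      blocks⇔goldenRootChain : ∀ S → (AboveB S ⊎ BelowB S) ⇔ GoldenRootChain S
      blocks⇔goldenRootChain S = mk⇔
        [ AboveB⇒goldenRootChain
        , (λ (T , T∈𝓜 , x , x∈ , st) → StartingAt⇒goldenRootChain
                                          (proj₁ (∈𝓜-golden-<b T∈𝓜 (∈elements⁻ x∈))) st) ]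
        goldenRootChain⇒blocks

      ∣C∣≡1+∣C∖r∣ : ∣ C ∣ ≡ suc ∣ C∖r ∣
      ∣C∣≡1+∣C∖r∣ = begin
        ∣ C ∣                  ≡⟨ cong ∣_∣ (⊆-antisym split join) ⟩
        ∣ ⁅ r ⁆ ∪ C∖r ∣        ≡⟨ ∣p∪q∣≡∣p∣+∣q∣ ⁅ r ⁆ C∖r r∉C∖r ⟩
        ∣ ⁅ r ⁆ ∣ + ∣ C∖r ∣    ≡⟨ cong (_+ ∣ C∖r ∣) (∣⁅x⁆∣≡1 r) ⟩
        suc ∣ C∖r ∣            ∎
        where
        open ≡-Reasoning
        r∉C∖r : Disjoint ⁅ r ⁆ C∖r
        r∉C∖r z∈⁅r⁆ z∈C∖r = proj₂ (∈C∖r⁻ z∈C∖r) (x∈⁅y⁆⇒x≡y r z∈⁅r⁆)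
        split : C ⊆ ⁅ r ⁆ ∪ C∖r
        split {z} z∈C with z ≟F r
        ... | yes refl = x∈p∪q⁺ (inj₁ (x∈⁅x⁆ r))
        ... | no z≢r = x∈p∪q⁺ (inj₂ (∈C∖r⁺ (z∈C , z≢r)))
        join : ⁅ r ⁆ ∪ C∖r ⊆ C
        join = ∪-lub (x∈p⇒⁅x⁆⊆p r∈C) (proj₁ ∘ ∈C∖r⁻)

      between≡ : ∀ {T x} → T ∈ᴸ 𝓜 → x ∈ T → between x ≡ strictlyAboveIn T x ∪ C∖r
      between≡ {T} {x} T∈𝓜 x∈T with 𝓜-shape T∈𝓜
      ... | ρ , refl , _ , ρ<b , noBetween = ⊆-antisym split join
        where
        x≤ρ : x ≤ ρ
        x≤ρ = proj₂ (∈goldenBelow⁻ x∈T)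
        split : between x ⊆ strictlyAboveIn (goldenBelow ρ) x ∪ C∖r
        split {z} z∈ with ∈between⁻ z∈
        ... | golden-z , x<z , z<r with upperSet-total x≤ρ (proj₁ x<z)
        ...   | inj₂ z≤ρ = x∈p∪q⁺ (inj₁ (∈strictlyAboveIn⁺
                              (∈goldenBelow⁺ (golden-z , z≤ρ) , x<z)))
        ...   | inj₁ ρ≤z with ≤⇒≡⊎< ρ≤z
        ...     | inj₁ refl = x∈p∪q⁺ (inj₁ (∈strictlyAboveIn⁺
                                (∈goldenBelow⁺ (golden-z , ≤-refl) , x<z)))
        ...     | inj₂ ρ<z with comparableToB z
        ...       | inj₁ b≤z = x∈p∪q⁺ (inj₂ (∈C∖r⁺ (⇒∈C b≤z golden-z , proj₂ z<r)))
        ...       | inj₂ z≤b = [ (λ { refl → x∈p∪q⁺ (inj₂ (∈C∖r⁺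
                                                                          (⇒∈C ≤-refl golden-z , proj₂ z<r))) })
                             , (λ z<b → ⊥-elim (noBetween golden-z ρ<z z<b)) ] (≤⇒≡⊎< z≤b)
        join : strictlyAboveIn (goldenBelow ρ) x ∪ C∖r ⊆ between x
        join {z} z∈ with x∈p∪q⁻ (strictlyAboveIn (goldenBelow ρ) x) C∖r z∈
        ... | inj₁ z∈above with ∈strictlyAboveIn⁻ z∈above
        ...   | z∈T , x<z with ∈goldenBelow⁻ z∈T
        ...     | golden-z , z≤ρ = ∈between⁺
                                     (golden-z , x<z , ≤-<-trans z≤ρ (<-≤-trans ρ<b b≤r))
        join {z} z∈ | inj₂ z∈C∖r with ∈C∖r⁻ z∈C∖r
        ... | z∈C , z≢r = ∈between⁺
                            ( proj₂ (∈C⇒ z∈C)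
                            , ≤-<-trans x≤ρ (<-≤-trans ρ<b (proj₁ (∈C⇒ z∈C)))
                            , ≢r⇒<r z≢r )

      ∣between∣ : ∀ {T x} → T ∈ᴸ 𝓜 → x ∈ T → ∣ between x ∣ ≡ ω T x + ∣ C ∣ ∸ 2
      ∣between∣ {T} {x} T∈𝓜 x∈T = begin
        ∣ between x ∣                                  ≡⟨ cong ∣_∣ (between≡ T∈𝓜 x∈T) ⟩
        ∣ strictlyAboveIn T x ∪ C∖r ∣                  ≡⟨ ∣p∪q∣≡∣p∣+∣q∣ _ C∖r disjoint ⟩
        ∣ strictlyAboveIn T x ∣ + ∣ C∖r ∣              ≡⟨ sym (cong (_∸ 1) (ℕ.+-suc _ ∣ C∖r ∣)) ⟩
        suc ∣ strictlyAboveIn T x ∣ + suc ∣ C∖r ∣ ∸ 2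
          ≡⟨ sym (cong₂ (λ a c → a + c ∸ 2) (ω≡1+∣strictlyAboveIn∣ x∈T) ∣C∣≡1+∣C∖r∣) ⟩
        ω T x + ∣ C ∣ ∸ 2                              ∎
        where
        open ≡-Reasoning
        disjoint : Disjoint (strictlyAboveIn T x) C∖r
        disjoint z∈above z∈C∖r =
          <-asym (proj₂ (∈𝓜-golden-<b T∈𝓜 (proj₁ (∈strictlyAboveIn⁻ z∈above))))
                 (proj₁ (∈C⇒ (proj₁ (∈C∖r⁻ z∈C∖r))))

      HasCard-AboveB : HasCard AboveB (2 ^ ∣ C∖r ∣)
      HasCard-AboveB = HasCard-interval ⁅ r ⁆ C∖r λ z∈⁅r⁆ z∈C∖r →
        proj₂ (∈C∖r⁻ z∈C∖r) (x∈⁅y⁆⇒x≡y r z∈⁅r⁆)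

      HasCard-StartingAt : ∀ {T x} → T ∈ᴸ 𝓜 → x ∈ T → HasCard (StartingAt x) (2 ^ (ω T x + ∣ C ∣ ∸ 2))
      HasCard-StartingAt {T} {x} T∈𝓜 x∈T =
        HasCard-≡ (cong (2 ^_) (∣between∣ T∈𝓜 x∈T))
                  (HasCard-interval (⁅ x ⁆ ∪ ⁅ r ⁆) (between x) disjoint)
        where
        disjoint : Disjoint (⁅ x ⁆ ∪ ⁅ r ⁆) (between x)
        disjoint z∈ z∈between with ∈between⁻ z∈between
        ... | _ , x<z , z<r = [ (λ z∈⁅x⁆ → proj₂ x<z (sym (x∈⁅y⁆⇒x≡y x z∈⁅x⁆)))
                              , (λ z∈⁅r⁆ → proj₂ z<r (x∈⁅y⁆⇒x≡y r z∈⁅r⁆)) ] (x∈p∪q⁻ ⁅ x ⁆ ⁅ r ⁆ z∈)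

      HasCard-BelowB : HasCard BelowB (sum (map (innerSum ∣ C ∣) 𝓜))
      HasCard-BelowB =
        HasCard-Σ 𝓜 𝓜-unique (innerSum ∣ C ∣) (λ T S → ∃ λ x → x ∈ᴸ elements T × StartingAt x S)
          (λ {T} {T′} T∈𝓜 T′∈𝓜 (x , x∈ , st) (x′ , x′∈ , st′) →
             𝓜-disjoint T∈𝓜 T′∈𝓜 (∈elements⁻ x∈)
                        (subst (_∈ T′) (sym (StartingAt-unique st st′)) (∈elements⁻ x′∈)))
          λ {T} T∈𝓜 → HasCard-Σ (elements T) (Unique.filter⁺ (_∈? T) (Unique.allFin⁺ n))
                        (λ x → 2 ^ (ω T x + ∣ C ∣ ∸ 2)) StartingAt (λ _ _ → StartingAt-unique)
                        (λ x∈ → HasCard-StartingAt T∈𝓜 (∈elements⁻ x∈))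

      HasCard-goldenRootChain : HasCard GoldenRootChain (2 ^ (∣ C ∣ ∸ 1) + sum (map (innerSum ∣ C ∣) 𝓜))
      HasCard-goldenRootChain =
        HasCard-cong blocks⇔goldenRootChain
          (HasCard-⊎ disjoint (HasCard-≡ (cong (λ c → 2 ^ (c ∸ 1)) (sym ∣C∣≡1+∣C∖r∣)) HasCard-AboveB)
                              HasCard-BelowB)
        where
        disjoint : ∀ S → AboveB S → BelowB S → ⊥
        disjoint S ab (T , T∈𝓜 , x , x∈ , st) =
          <-asym (proj₂ (∈𝓜-golden-<b T∈𝓜 (∈elements⁻ x∈)))
                 (proj₁ (∈C⇒ (AboveB⇒⊆C ab (proj₁ (StartingAt-least st)))))

open import Data.List.Membership.Propositional using (_∈_)
open PromotionPreimages using (module GoldenRootChains)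

theorem3p3 : (n : ℕ) (P : FinPoset n) → FinPoset.IsRootedTreePoset P →
    (L : Vec ℕ n) → FinPoset.IsLabeling P L →
    (b : Fin n) → FinPoset.IsHighestBranch P b →
    (C : Subset n) → FinPoset.IsMaxGoldenChainAbove P L b C →
    (𝓜 : List (Subset n)) → Unique 𝓜 → (∀ T → (T ∈ 𝓜) ⇔ FinPoset.InM P L b T) →
    (∀ x → lookup L x ≡ n → FinPoset.IsMaximal P x) →
    HasCard (λ L′ → FinPoset.IsLabeling P L′ × FinPoset.∂ P L′ ≡ L)
      (2 ^ (∣ C ∣ ∸ 1) + sum (map (FinPoset.innerSum P ∣ C ∣) 𝓜))
theorem3p3 n P tree L isLabeling b highest C maxChainC 𝓜 𝓜-unique ∈𝓜⇔ topMaximal =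
  HasCard-∂⁻¹ (Count.HasCard-goldenRootChain C maxChainC 𝓜 𝓜-unique ∈𝓜⇔)
  where open GoldenRootChains P tree L isLabeling b highest topMaximal
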